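{- In IITT, if $\Gamma\vdash t:T$ then there is a weak head normal form $a$ with $t\searrow a$ and $\Gamma\vdash t=a:T$.
   Context: Irrelevant Intensional Type Theory (IITT) is defined as follows. Sorts are $\mathsf{Set}_k$ ($k\in\mathbb{N}$), with $\mathsf{Axiom}=\{(\mathsf{Set}_i,\mathsf{Set}_{i+1})\mid i\in\mathbb{N}\}$ and $\mathsf{Rule}=\{(\mathsf{Set}_i,\mathsf{Set}_j,\mathsf{Set}_{\max(i,j)})\mid i,j\in\mathbb{N}\}$. Annotations are $\star\in\{:,\div\}$ (relevant, irrelevant). Expressions: $t,u,T,U ::= s \mid (x\star U)\to^{s,s'}T \mid x \mid \lambda x\star U.\,t \mid t\star u$, where $(x\star U)\to^{s,s'}T$ is a relevant or irrelevant dependent function type annotated with the sort $s$ of its domain and $s'$ of its codomain, and $t\star u$ is relevant application (also written $t\,u$) or irrelevant application $t\div u$. Expressions are taken modulo $\alpha$-equivalence; $[u/x]t$ is capture-avoiding substitution. Contexts: $\Gamma ::= () \mid \Gamma.\,x\star T$ (variables distinct). Resurrection $\Gamma^{\oplus}$ replaces each binding $x\div T$ by $x:T$. Abbreviations: $\Gamma\vdash t\div T$ means $\Gamma^\oplus\vdash t:T$; $\Gamma\vdash t=t'\div T$ means $\Gamma\vdash t\div T$ and $\Gamma\vdash t'\div T$; $\Gamma\vdash T$ means $\Gamma\vdash T:s$ for some sort $s$; $\Gamma\vdash T=T'$ means $\Gamma\vdash T=T':s$ for some $s$. The judgements $\vdash\Gamma$, $\Gamma\vdash t:T$, $\Gamma\vdash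 t=t':T$ are defined mutually inductively by: (contexts) $\vdash()$; from $\vdash\Gamma$ and $\Gamma\vdash T$ infer $\vdash\Gamma.x\star T$. (typing) from $\vdash\Gamma$, $(s,s')\in\mathsf{Axiom}$ infer $\Gamma\vdash s:s'$; from $\Gamma\vdash U:s_1$, $\Gamma.x\star U\vdash T:s_2$, $(s_1,s_2,s_3)\in\mathsf{Rule}$ infer $\Gamma\vdash (x\star U)\to^{s_1,s_2}T:s_3$; from $\vdash\Gamma$ and $(x:U)\in\Gamma$ infer $\Gamma\vdash x:U$ (no variable rule for irrelevant bindings); from $\Gamma.x\star U\vdash t:T$ and $\Gamma\vdash (x\star U)\to^{s,s'}T$ infer $\Gamma\vdash \lambda x\star U.t:(x\star U)\to^{s,s'}T$; from $\Gamma\vdash t:(x\star U)\to^{s,s'}T$ and $\Gamma\vdash u\star U$ infer $\Gamma\vdash t\star u:[u/x]T$; from $\Gamma\vdash t:T$ and $\Gamma\vdash T=T'$ infer $\Gamma\vdash t:T'$. (equality) $\beta$: from $\Gamma.x\star U\vdash t:T$ and $\Gamma\vdash u\star U$ infer $\Gamma\vdash(\lambda x\star U.t)\star u=[u/x]t:[u/x]T$; $\eta$: from $\Gamma\vdash t:(x\star U)\to^{s,s'}T$ infer $\Gamma\vdash t=\lambda x\star U.(t\star x):(x\star U)\to^{s,s'}T$; reflexivity, symmetry, transitivity; from $\Gamma\vdash U=U':s_1$, $\Gamma.x\star U\vdash T=T':s_2$, $(s_1,s_2,s_3)\in\mathsf{Rule}$ infer $\Gamma\vdash (x\star U)\to^{s_1,s_2}T=(x\star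 U')\to^{s_1,s_2}T':s_3$; from $\Gamma\vdash U=U':s_1$, $\Gamma.x\star U\vdash T:s_2$, $\Gamma.x\star U\vdash t=t':T$ infer $\Gamma\vdash\lambda x\star U.t=\lambda x\star U'.t':(x\star U)\to^{s_1,s_2}T$; from $\Gamma\vdash t=t':(x\star U)\to^{s,s'}T$ and $\Gamma\vdash u=u'\star U$ infer $\Gamma\vdash t\star u=t'\star u':[u/x]T$; from $\Gamma\vdash t=t':T$ and $\Gamma\vdash T=T'$ infer $\Gamma\vdash t=t':T'$. Weak head normal forms: $a ::= s\mid (x\star U)\to^{s,s'}T\mid \lambda x\star U.t\mid n$, with neutrals $n ::= x\mid n\star u$. Weak head evaluation $t\searrow a$ and active application $f\,@^\star u\searrow a$ are defined by: $a\searrow a$ for a whnf $a$; if $t\searrow f$ and $f\,@^\star u\searrow a$ then $t\star u\searrow a$; if $[u/x]t\searrow a$ then $(\lambda x\star U.t)\,@^\star u\searrow a$; $n\,@^\star u\searrow n\star u$ for neutral $n$. -}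

module Defs where

open import Data.Nat using (ℕ; zero; suc; _⊔_)
open import Data.Product using (Σ; _×_; _,_)

data Sort : Set where
  𝒮 : ℕ → Sort

data Axiom : Sort → Sort → Set where
  ax : ∀ i → Axiom (𝒮 i) (𝒮 (suc i))

data Rule : Sort → Sort → Sort → Set where
  rl : ∀ i j → Rule (𝒮 i) (𝒮 j) (𝒮 (i ⊔ j))

data Ann : Set where
  rel : Ann
  irr : Ann

data Exp : Set where
  srt : Sort → Exp
  Π   : Ann → Sort → Sort → Exp → Exp → Exp   -- Π ⋆ s s' U T = (x ⋆ U) →^{s,s'} T, x bound in T
  var : ℕ → Exp
  lam : Ann → Exp → Exp → Exp                 -- lam ⋆ U t = λ x ⋆ U. t, x bound in t
  app : Ann → Exp → Exp → Exp

liftR : (ℕ → ℕ) → ℕ → ℕ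
liftR ρ zero    = zero
liftR ρ (suc n) = suc (ρ n)

ren : (ℕ → ℕ) → Exp → Exp
ren ρ (srt s)         = srt s
ren ρ (Π a s s' U T)  = Π a s s' (ren ρ U) (ren (liftR ρ) T)
ren ρ (var x)         = var (ρ x)
ren ρ (lam a U t)     = lam a (ren ρ U) (ren (liftR ρ) t)
ren ρ (app a t u)     = app a (ren ρ t) (ren ρ u)

wk : Exp → Exp
wk = ren suc

liftS : (ℕ → Exp) → ℕ → Exp
liftS σ zero    = var zero
liftS σ (suc n) = wk (σ n)

sub : (ℕ → Exp) → Exp → Exp
sub σ (srt s)         = srt s
sub σ (Π a s s' U T)  = Π a s s' (sub σ U) (sub (liftS σ) T)
sub σ (var x)         = σ x
sub σ (lam a U t)     = lam a (sub σ U) (sub (liftS σ) t)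
sub σ (app a t u)     = app a (sub σ t) (sub σ u)

single : Exp → ℕ → Exp
single u zero    = u
single u (suc n) = var n

_[_] : Exp → Exp → Exp
t [ u ] = sub (single u) t

infixl 5 _▸_

data Ctx : Set where
  ε   : Ctx
  _▸_ : Ctx → Ann × Exp → Ctx

_⊕ : Ctx → Ctx
ε ⊕             = ε
(Γ ▸ (_ , T)) ⊕ = (Γ ⊕) ▸ (rel , T)

-- (x : U) ∈ Γ  : variable x is bound *relevantly* in Γ with type U
-- (weakened to live in Γ)
data _∋_∶_ : Ctx → ℕ → Exp → Set where
  here  : ∀ {Γ U} → (Γ ▸ (rel , U)) ∋ zero ∶ wk U
  there : ∀ {Γ b x U} → Γ ∋ x ∶ U → (Γ ▸ b) ∋ suc x ∶ wk U

infix 4 ⊢_ _⊢_∶_ _⊢_≡_∶_ _⊢_⦂[_]_ _⊢_≡_⦂[_]_ _⊢_≡ty_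

mutual
  data ⊢_ : Ctx → Set where
    ε-wf : ⊢ ε
    ▸-wf : ∀ {Γ a T s} → ⊢ Γ → Γ ⊢ T ∶ srt s → ⊢ (Γ ▸ (a , T))

  data _⊢_⦂[_]_ : Ctx → Exp → Ann → Exp → Set where
    ⦂rel : ∀ {Γ t T} → Γ ⊢ t ∶ T → Γ ⊢ t ⦂[ rel ] T
    ⦂irr : ∀ {Γ t T} → (Γ ⊕) ⊢ t ∶ T → Γ ⊢ t ⦂[ irr ] T

  data _⊢_≡_⦂[_]_ : Ctx → Exp → Exp → Ann → Exp → Set where
    ≡rel : ∀ {Γ t t' T} → Γ ⊢ t ≡ t' ∶ T → Γ ⊢ t ≡ t' ⦂[ rel ] T
    ≡irr : ∀ {Γ t t' T} → (Γ ⊕) ⊢ t ∶ T → (Γ ⊕) ⊢ t' ∶ T → Γ ⊢ t ≡ t' ⦂[ irr ] T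

  data _⊢_≡ty_ : Ctx → Exp → Exp → Set where
    ≡ty : ∀ {Γ T T' s} → Γ ⊢ T ≡ T' ∶ srt s → Γ ⊢ T ≡ty T'

  data _⊢_∶_ : Ctx → Exp → Exp → Set where
    t-sort : ∀ {Γ s s'} → ⊢ Γ → Axiom s s' → Γ ⊢ srt s ∶ srt s'
    t-Π    : ∀ {Γ a U T s₁ s₂ s₃} →
             Γ ⊢ U ∶ srt s₁ → (Γ ▸ (a , U)) ⊢ T ∶ srt s₂ → Rule s₁ s₂ s₃ →
             Γ ⊢ Π a s₁ s₂ U T ∶ srt s₃
    t-var  : ∀ {Γ x U} → ⊢ Γ → Γ ∋ x ∶ U → Γ ⊢ var x ∶ U
    t-lam  : ∀ {Γ a U t T s s' s''} →
             (Γ ▸ (a , U)) ⊢ t ∶ T → Γ ⊢ Π a s s' U T ∶ srt s'' →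
             Γ ⊢ lam a U t ∶ Π a s s' U T
    t-app  : ∀ {Γ a t u U T s s'} →
             Γ ⊢ t ∶ Π a s s' U T → Γ ⊢ u ⦂[ a ] U →
             Γ ⊢ app a t u ∶ T [ u ]
    t-conv : ∀ {Γ t T T'} → Γ ⊢ t ∶ T → Γ ⊢ T ≡ty T' → Γ ⊢ t ∶ T'

  data _⊢_≡_∶_ : Ctx → Exp → Exp → Exp → Set where
    e-β     : ∀ {Γ a U t T u} →
              (Γ ▸ (a , U)) ⊢ t ∶ T → Γ ⊢ u ⦂[ a ] U →
              Γ ⊢ app a (lam a U t) u ≡ t [ u ] ∶ T [ u ]
    e-η     : ∀ {Γ a U T s s' t} →
              Γ ⊢ t ∶ Π a s s' U T →
              Γ ⊢ t ≡ lam a U (app a (wk t) (var zero)) ∶ Π a s s' U T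
    e-refl  : ∀ {Γ t T} → Γ ⊢ t ∶ T → Γ ⊢ t ≡ t ∶ T
    e-sym   : ∀ {Γ t t' T} → Γ ⊢ t ≡ t' ∶ T → Γ ⊢ t' ≡ t ∶ T
    e-trans : ∀ {Γ t t' t'' T} → Γ ⊢ t ≡ t' ∶ T → Γ ⊢ t' ≡ t'' ∶ T → Γ ⊢ t ≡ t'' ∶ T
    e-Π     : ∀ {Γ a U U' T T' s₁ s₂ s₃} →
              Γ ⊢ U ≡ U' ∶ srt s₁ → (Γ ▸ (a , U)) ⊢ T ≡ T' ∶ srt s₂ → Rule s₁ s₂ s₃ →
              Γ ⊢ Π a s₁ s₂ U T ≡ Π a s₁ s₂ U' T' ∶ srt s₃
    e-lam   : ∀ {Γ a U U' T t t' s₁ s₂} →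
              Γ ⊢ U ≡ U' ∶ srt s₁ → (Γ ▸ (a , U)) ⊢ T ∶ srt s₂ →
              (Γ ▸ (a , U)) ⊢ t ≡ t' ∶ T →
              Γ ⊢ lam a U t ≡ lam a U' t' ∶ Π a s₁ s₂ U T
    e-app   : ∀ {Γ a t t' u u' U T s s'} →
              Γ ⊢ t ≡ t' ∶ Π a s s' U T → Γ ⊢ u ≡ u' ⦂[ a ] U →
              Γ ⊢ app a t u ≡ app a t' u' ∶ T [ u ]
    e-conv  : ∀ {Γ t t' T T'} → Γ ⊢ t ≡ t' ∶ T → Γ ⊢ T ≡ty T' → Γ ⊢ t ≡ t' ∶ T'

data Neutral : Exp → Set where
  ne-var : ∀ {x} → Neutral (var x)
  ne-app : ∀ {a n u} → Neutral n → Neutral (app a n u)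

data Whnf : Exp → Set where
  wh-srt : ∀ {s} → Whnf (srt s)
  wh-Π   : ∀ {a s s' U T} → Whnf (Π a s s' U T)
  wh-lam : ∀ {a U t} → Whnf (lam a U t)
  wh-ne  : ∀ {n} → Neutral n → Whnf n

infix 4 _↘_ _·[_]_↘_

mutual
  data _↘_ : Exp → Exp → Set where
    ↘-whnf : ∀ {a} → Whnf a → a ↘ a
    ↘-app  : ∀ {⋆ t u f a} → t ↘ f → f ·[ ⋆ ] u ↘ a → app ⋆ t u ↘ a

  data _·[_]_↘_ : Exp → Ann → Exp → Exp → Set where
    ·-β  : ∀ {⋆ U t u a} → (t [ u ]) ↘ a → lam ⋆ U t ·[ ⋆ ] u ↘ a
    ·-ne : ∀ {⋆ n u} → Neutral n → n ·[ ⋆ ] u ↘ app ⋆ n u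

module Submission where

-- Weak head normalisation is proved by a Kripke logical relation indexed by universe levels.
-- A type is reducible at level l if it evaluates to a universe below l, to a neutral, or to a
-- Π-type whose domain and codomain are reducible under every weakening; reducible terms are
-- defined by recursion on reducible types and always come with a weak head normal form to which
-- they evaluate and with which they are judgmentally equal. Irrelevant arguments are interpreted
-- in the resurrected context and are never compared. Validity, i.e. reducibility under all pairs
-- of reducibly equal reducible substitutions, is preserved by every typing and equality rule, so
-- each well-typed term is valid; the identity substitution then gives the theorem.

open import Defs
open import Data.Nat using (ℕ; zero; suc; _≤′_; _<′_; ≤′-refl; ≤′-step; _⊔_)
open import Data.Nat.Properties using (≤′-trans; ≤⇒≤′; m≤m⊔n; m≤n⊔m)
open import Data.Product using (Σ; _×_; _,_; proj₁; proj₂)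
open import Data.Unit using (⊤; tt)
open import Data.Empty using (⊥; ⊥-elim)
open import Relation.Binary.PropositionalEquality renaming (_≡_ to _≣_) hiding ([_])
open import Function using (_∘_)

Ren : Set
Ren = ℕ → ℕ

Sub : Set
Sub = ℕ → Exp

cons : Exp → Sub → Sub
cons u σ zero    = u
cons u σ (suc n) = σ n

tailS : Sub → Sub
tailS σ = σ ∘ suc

liftR-cong : ∀ {ρ ρ'} → ρ ≗ ρ' → liftR ρ ≗ liftR ρ'
liftR-cong e zero    = refl
liftR-cong e (suc n) = cong suc (e n)

ren-cong : ∀ {ρ ρ'} → ρ ≗ ρ' → ren ρ ≗ ren ρ'
ren-cong e (srt s)        = refl
ren-cong e (Π a s s' U T) = cong₂ (Π a s s') (ren-cong e U) (ren-cong (liftR-cong e) T)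
ren-cong e (var x)        = cong var (e x)
ren-cong e (lam a U t)    = cong₂ (lam a) (ren-cong e U) (ren-cong (liftR-cong e) t)
ren-cong e (app a t u)    = cong₂ (app a) (ren-cong e t) (ren-cong e u)

liftS-cong : ∀ {σ σ'} → σ ≗ σ' → liftS σ ≗ liftS σ'
liftS-cong e zero    = refl
liftS-cong e (suc n) = cong wk (e n)

sub-cong : ∀ {σ σ'} → σ ≗ σ' → sub σ ≗ sub σ'
sub-cong e (srt s)        = refl
sub-cong e (Π a s s' U T) = cong₂ (Π a s s') (sub-cong e U) (sub-cong (liftS-cong e) T)
sub-cong e (var x)        = e x
sub-cong e (lam a U t)    = cong₂ (lam a) (sub-cong e U) (sub-cong (liftS-cong e) t)
sub-cong e (app a t u)    = cong₂ (app a) (sub-cong e t) (sub-cong e u)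

liftR-id : liftR (λ n → n) ≗ (λ n → n)
liftR-id zero    = refl
liftR-id (suc n) = refl

ren-id : ren (λ n → n) ≗ (λ t → t)
ren-id (srt s)        = refl
ren-id (Π a s s' U T) = cong₂ (Π a s s') (ren-id U) (trans (ren-cong liftR-id T) (ren-id T))
ren-id (var x)        = refl
ren-id (lam a U t)    = cong₂ (lam a) (ren-id U) (trans (ren-cong liftR-id t) (ren-id t))
ren-id (app a t u)    = cong₂ (app a) (ren-id t) (ren-id u)

liftS-id : liftS var ≗ var
liftS-id zero    = refl
liftS-id (suc n) = refl

sub-id : sub var ≗ (λ t → t)
sub-id (srt s)        = refl
sub-id (Π a s s' U T) = cong₂ (Π a s s') (sub-id U) (trans (sub-cong liftS-id T) (sub-id T))
sub-id (var x)        = refl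
sub-id (lam a U t)    = cong₂ (lam a) (sub-id U) (trans (sub-cong liftS-id t) (sub-id t))
sub-id (app a t u)    = cong₂ (app a) (sub-id t) (sub-id u)

liftR-∘ : ∀ ρ ρ' → liftR ρ ∘ liftR ρ' ≗ liftR (ρ ∘ ρ')
liftR-∘ ρ ρ' zero    = refl
liftR-∘ ρ ρ' (suc n) = refl

ren-ren : ∀ ρ ρ' t → ren ρ (ren ρ' t) ≣ ren (ρ ∘ ρ') t
ren-ren ρ ρ' (srt s)        = refl
ren-ren ρ ρ' (Π a s s' U T) = cong₂ (Π a s s') (ren-ren ρ ρ' U)
  (trans (ren-ren (liftR ρ) (liftR ρ') T) (ren-cong (liftR-∘ ρ ρ') T))
ren-ren ρ ρ' (var x)        = refl
ren-ren ρ ρ' (lam a U t)    = cong₂ (lam a) (ren-ren ρ ρ' U)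
  (trans (ren-ren (liftR ρ) (liftR ρ') t) (ren-cong (liftR-∘ ρ ρ') t))
ren-ren ρ ρ' (app a t u)    = cong₂ (app a) (ren-ren ρ ρ' t) (ren-ren ρ ρ' u)

liftS-liftR : ∀ σ ρ → liftS σ ∘ liftR ρ ≗ liftS (σ ∘ ρ)
liftS-liftR σ ρ zero    = refl
liftS-liftR σ ρ (suc n) = refl

sub-ren : ∀ σ ρ t → sub σ (ren ρ t) ≣ sub (σ ∘ ρ) t
sub-ren σ ρ (srt s)        = refl
sub-ren σ ρ (Π a s s' U T) = cong₂ (Π a s s') (sub-ren σ ρ U)
  (trans (sub-ren (liftS σ) (liftR ρ) T) (sub-cong (liftS-liftR σ ρ) T))
sub-ren σ ρ (var x)        = refl
sub-ren σ ρ (lam a U t)    = cong₂ (lam a) (sub-ren σ ρ U)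
  (trans (sub-ren (liftS σ) (liftR ρ) t) (sub-cong (liftS-liftR σ ρ) t))
sub-ren σ ρ (app a t u)    = cong₂ (app a) (sub-ren σ ρ t) (sub-ren σ ρ u)

wk-liftR : ∀ ρ t → ren (liftR ρ) (wk t) ≣ wk (ren ρ t)
wk-liftR ρ t = trans (ren-ren (liftR ρ) suc t) (sym (ren-ren suc ρ t))

liftR-liftS : ∀ ρ σ → ren (liftR ρ) ∘ liftS σ ≗ liftS (ren ρ ∘ σ)
liftR-liftS ρ σ zero    = refl
liftR-liftS ρ σ (suc n) = wk-liftR ρ (σ n)

ren-sub : ∀ ρ σ t → ren ρ (sub σ t) ≣ sub (ren ρ ∘ σ) t
ren-sub ρ σ (srt s)        = refl
ren-sub ρ σ (Π a s s' U T) = cong₂ (Π a s s') (ren-sub ρ σ U)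
  (trans (ren-sub (liftR ρ) (liftS σ) T) (sub-cong (liftR-liftS ρ σ) T))
ren-sub ρ σ (var x)        = refl
ren-sub ρ σ (lam a U t)    = cong₂ (lam a) (ren-sub ρ σ U)
  (trans (ren-sub (liftR ρ) (liftS σ) t) (sub-cong (liftR-liftS ρ σ) t))
ren-sub ρ σ (app a t u)    = cong₂ (app a) (ren-sub ρ σ t) (ren-sub ρ σ u)

wk-liftS : ∀ σ t → sub (liftS σ) (wk t) ≣ wk (sub σ t)
wk-liftS σ t = trans (sub-ren (liftS σ) suc t) (sym (ren-sub suc σ t))

liftS-∘ : ∀ σ τ → sub (liftS σ) ∘ liftS τ ≗ liftS (sub σ ∘ τ)
liftS-∘ σ τ zero    = refl
liftS-∘ σ τ (suc n) = wk-liftS σ (τ n)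

sub-sub : ∀ σ τ t → sub σ (sub τ t) ≣ sub (sub σ ∘ τ) t
sub-sub σ τ (srt s)        = refl
sub-sub σ τ (Π a s s' U T) = cong₂ (Π a s s') (sub-sub σ τ U)
  (trans (sub-sub (liftS σ) (liftS τ) T) (sub-cong (liftS-∘ σ τ) T))
sub-sub σ τ (var x)        = refl
sub-sub σ τ (lam a U t)    = cong₂ (lam a) (sub-sub σ τ U)
  (trans (sub-sub (liftS σ) (liftS τ) t) (sub-cong (liftS-∘ σ τ) t))
sub-sub σ τ (app a t u)    = cong₂ (app a) (sub-sub σ τ t) (sub-sub σ τ u)

ren-as-sub : ∀ ρ t → ren ρ t ≣ sub (var ∘ ρ) t
ren-as-sub ρ t = trans (sym (sub-id (ren ρ t))) (sub-ren var ρ t)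

ren-ren-liftR : ∀ ρ ρ' t → ren (liftR ρ) (ren (liftR ρ') t) ≣ ren (liftR (ρ ∘ ρ')) t
ren-ren-liftR ρ ρ' t = trans (ren-ren (liftR ρ) (liftR ρ') t) (ren-cong (liftR-∘ ρ ρ') t)

ren-liftR-id : ∀ t → ren (liftR (λ n → n)) t ≣ t
ren-liftR-id t = trans (ren-cong liftR-id t) (ren-id t)

sub-wk : ∀ σ t → sub σ (wk t) ≣ sub (tailS σ) t
sub-wk σ = sub-ren σ suc

wk-single : ∀ t u → (wk t) [ u ] ≣ t
wk-single t u = trans (sub-wk (single u) t) (sub-id t)

wk-ren-single : ∀ ρ t u → (ren (liftR ρ) (wk t)) [ u ] ≣ ren ρ t
wk-ren-single ρ t u = trans (cong (_[ u ]) (wk-liftR ρ t)) (wk-single (ren ρ t) u)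

cons-split : ∀ u σ t → sub (cons u σ) t ≣ (sub (liftS σ) t) [ u ]
cons-split u σ t = trans (sub-cong cons≗ t) (sym (sub-sub (single u) (liftS σ) t))
  where
  cons≗ : cons u σ ≗ sub (single u) ∘ liftS σ
  cons≗ zero    = refl
  cons≗ (suc n) = sym (wk-single (σ n) u)

sub-single-cons : ∀ σ t u → sub σ (t [ u ]) ≣ sub (cons (sub σ u) σ) t
sub-single-cons σ t u = trans (sub-sub σ (single u) t) (sub-cong single≗ t)
  where
  single≗ : sub σ ∘ single u ≗ cons (sub σ u) σ
  single≗ zero    = refl
  single≗ (suc n) = refl

sub-single : ∀ σ t u → sub σ (t [ u ]) ≣ (sub (liftS σ) t) [ sub σ u ]
sub-single σ t u = trans (sub-single-cons σ t u) (cons-split (sub σ u) σ t)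

ren-single : ∀ ρ t u → ren ρ (t [ u ]) ≣ (ren (liftR ρ) t) [ ren ρ u ]
ren-single ρ t u = begin
  ren ρ (t [ u ])                           ≡⟨ ren-as-sub ρ (t [ u ]) ⟩
  sub (var ∘ ρ) (t [ u ])                   ≡⟨ sub-single (var ∘ ρ) t u ⟩
  (sub (liftS (var ∘ ρ)) t) [ sub (var ∘ ρ) u ]
    ≡⟨ cong₂ _[_] (trans (sub-cong liftS-var t) (sym (ren-as-sub (liftR ρ) t))) (sym (ren-as-sub ρ u)) ⟩
  (ren (liftR ρ) t) [ ren ρ u ]             ∎
  where
  open ≡-Reasoning
  liftS-var : liftS (var ∘ ρ) ≗ var ∘ liftR ρ
  liftS-var zero    = refl
  liftS-var (suc n) = refl

liftR-suc-var0 : ∀ t → (ren (liftR suc) t) [ var zero ] ≣ t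
liftR-suc-var0 t = trans (sub-ren (single (var zero)) (liftR suc) t) (trans (sub-cong single-var0 t) (sub-id t))
  where
  single-var0 : single (var zero) ∘ liftR suc ≗ var
  single-var0 zero    = refl
  single-var0 (suc n) = refl

cons-ren : ∀ u ρ σ t → sub (cons u (ren ρ ∘ σ)) t ≣ (ren (liftR ρ) (sub (liftS σ) t)) [ u ]
cons-ren u ρ σ t = trans (cons-split u (ren ρ ∘ σ) t)
  (cong (_[ u ]) (sym (trans (ren-sub (liftR ρ) (liftS σ) t) (sub-cong (liftR-liftS ρ σ) t))))

data _∋_∷[_]_ : Ctx → ℕ → Ann → Exp → Set where
  here  : ∀ {Γ a U} → (Γ ▸ (a , U)) ∋ zero ∷[ a ] wk U
  there : ∀ {Γ b x a U} → Γ ∋ x ∷[ a ] U → (Γ ▸ b) ∋ suc x ∷[ a ] wk U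

to∷ : ∀ {Γ x U} → Γ ∋ x ∶ U → Γ ∋ x ∷[ rel ] U
to∷ here = here
to∷ (there p) = there (to∷ p)

from∷ : ∀ {Γ x U} → Γ ∋ x ∷[ rel ] U → Γ ∋ x ∶ U
from∷ here = here
from∷ (there p) = there (from∷ p)

⊕∋ : ∀ {Γ x a U} → Γ ∋ x ∷[ a ] U → (Γ ⊕) ∋ x ∷[ rel ] U
⊕∋ here = here
⊕∋ (there p) = there (⊕∋ p)

⊕∋⁻ : ∀ {Γ x a U} → (Γ ⊕) ∋ x ∷[ a ] U → Σ Ann (λ a' → Γ ∋ x ∷[ a' ] U)
⊕∋⁻ {Γ ▸ (b , V)} here = b , here
⊕∋⁻ {Γ ▸ _} (there p) with ⊕∋⁻ p
... | a' , q = a' , there q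

⊕-rel : ∀ {Γ x a U} → (Γ ⊕) ∋ x ∷[ a ] U → a ≣ rel
⊕-rel {Γ ▸ _} here = refl
⊕-rel {Γ ▸ _} (there p) = ⊕-rel p

≣ty : ∀ {Γ t T T'} → T ≣ T' → Γ ⊢ t ∶ T → Γ ⊢ t ∶ T'
≣ty refl d = d
≣eq : ∀ {Γ t₁ t₁' t₂ t₂' T T'} → t₁ ≣ t₁' → t₂ ≣ t₂' → T ≣ T' → Γ ⊢ t₁ ≡ t₂ ∶ T → Γ ⊢ t₁' ≡ t₂' ∶ T'
≣eq refl refl refl d = d
≣∋ : ∀ {Γ x a U U'} → U ≣ U' → Γ ∋ x ∷[ a ] U → Γ ∋ x ∷[ a ] U'
≣∋ refl p = p

data _≤ₐ_ : Ann → Ann → Set where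
  ≤ₐ-refl : ∀ {a} → a ≤ₐ a
  irr≤rel : irr ≤ₐ rel

≤ₐ-trans : ∀ {a b c} → a ≤ₐ b → b ≤ₐ c → a ≤ₐ c
≤ₐ-trans ≤ₐ-refl q = q
≤ₐ-trans irr≤rel ≤ₐ-refl = irr≤rel

rel≤ : ∀ {a} → rel ≤ₐ a → a ≣ rel
rel≤ ≤ₐ-refl = refl

data _≼_ : Ctx → Ctx → Set where
  ≼ε : ε ≼ ε
  ≼▸ : ∀ {Γ Γ' a a' U} → Γ ≼ Γ' → a ≤ₐ a' → (Γ ▸ (a , U)) ≼ (Γ' ▸ (a' , U))

≼⊕ : ∀ {Γ Γ'} → Γ ≼ Γ' → Γ ⊕ ≣ Γ' ⊕
≼⊕ ≼ε = refl
≼⊕ (≼▸ p _) = cong (_▸ _) (≼⊕ p)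

≼-res : ∀ Γ → Γ ≼ (Γ ⊕)
≼-res ε = ≼ε
≼-res (Γ ▸ (rel , _)) = ≼▸ (≼-res Γ) ≤ₐ-refl
≼-res (Γ ▸ (irr , _)) = ≼▸ (≼-res Γ) irr≤rel

≼∋ : ∀ {Γ Γ' x U} → Γ ≼ Γ' → Γ ∋ x ∶ U → Γ' ∋ x ∶ U
≼∋ (≼▸ p ≤ₐ-refl) here = here
≼∋ (≼▸ p _) (there q) = there (≼∋ p q)

mutual
  resCtx : ∀ {Γ Γ'} → Γ ≼ Γ' → ⊢ Γ → ⊢ Γ'
  resCtx ≼ε ε-wf = ε-wf
  resCtx (≼▸ p _) (▸-wf d dT) = ▸-wf (resCtx p d) (resTm p dT)

  resTm : ∀ {Γ Γ' t T} → Γ ≼ Γ' → Γ ⊢ t ∶ T → Γ' ⊢ t ∶ T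
  resTm p (t-sort d x) = t-sort (resCtx p d) x
  resTm p (t-Π dU dT r) = t-Π (resTm p dU) (resTm (≼▸ p ≤ₐ-refl) dT) r
  resTm p (t-var d x) = t-var (resCtx p d) (≼∋ p x)
  resTm p (t-lam d dΠ) = t-lam (resTm (≼▸ p ≤ₐ-refl) d) (resTm p dΠ)
  resTm p (t-app d du) = t-app (resTm p d) (resArg p du)
  resTm p (t-conv d e) = t-conv (resTm p d) (resTyEq p e)

  resArg : ∀ {Γ Γ' t a T} → Γ ≼ Γ' → Γ ⊢ t ⦂[ a ] T → Γ' ⊢ t ⦂[ a ] T
  resArg p (⦂rel d) = ⦂rel (resTm p d)
  resArg p (⦂irr d) = ⦂irr (subst (λ G → G ⊢ _ ∶ _) (≼⊕ p) d)

  resArgEq : ∀ {Γ Γ' t t' a T} → Γ ≼ Γ' → Γ ⊢ t ≡ t' ⦂[ a ] T → Γ' ⊢ t ≡ t' ⦂[ a ] T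
  resArgEq p (≡rel d) = ≡rel (resEq p d)
  resArgEq p (≡irr d d') = ≡irr (subst (λ G → G ⊢ _ ∶ _) (≼⊕ p) d) (subst (λ G → G ⊢ _ ∶ _) (≼⊕ p) d')

  resTyEq : ∀ {Γ Γ' T T'} → Γ ≼ Γ' → Γ ⊢ T ≡ty T' → Γ' ⊢ T ≡ty T'
  resTyEq p (≡ty e) = ≡ty (resEq p e)

  resEq : ∀ {Γ Γ' t t' T} → Γ ≼ Γ' → Γ ⊢ t ≡ t' ∶ T → Γ' ⊢ t ≡ t' ∶ T
  resEq p (e-β d du) = e-β (resTm (≼▸ p ≤ₐ-refl) d) (resArg p du)
  resEq p (e-η d) = e-η (resTm p d)
  resEq p (e-refl d) = e-refl (resTm p d)
  resEq p (e-sym e) = e-sym (resEq p e)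
  resEq p (e-trans e e') = e-trans (resEq p e) (resEq p e')
  resEq p (e-Π e e' r) = e-Π (resEq p e) (resEq (≼▸ p ≤ₐ-refl) e') r
  resEq p (e-lam e d e') = e-lam (resEq p e) (resTm (≼▸ p ≤ₐ-refl) d) (resEq (≼▸ p ≤ₐ-refl) e')
  resEq p (e-app e e') = e-app (resEq p e) (resArgEq p e')
  resEq p (e-conv e e') = e-conv (resEq p e) (resTyEq p e')

⊕ctx : ∀ {Γ} → ⊢ Γ → ⊢ (Γ ⊕)
⊕ctx {Γ} = resCtx (≼-res Γ)

⊕eq : ∀ {Γ t t' T} → Γ ⊢ t ≡ t' ∶ T → (Γ ⊕) ⊢ t ≡ t' ∶ T
⊕eq {Γ} = resEq (≼-res Γ)

-- A weakening may also turn irrelevant bindings into relevant ones, so that Γ⊕ is a weakening of Γ.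
record W (Δ Γ : Ctx) (ρ : Ren) : Set where
  constructor mkW
  field
    wΔ   : ⊢ Δ
    wlook : ∀ {x a U} → Γ ∋ x ∷[ a ] U → Σ Ann (λ a' → (a ≤ₐ a') × (Δ ∋ ρ x ∷[ a' ] ren ρ U))
open W public

W⊕ : ∀ {Δ Γ ρ} → W Δ Γ ρ → W (Δ ⊕) (Γ ⊕) ρ
W⊕ w = mkW (⊕ctx (wΔ w)) look
  where
  look : ∀ {x a U} → _ ∋ x ∷[ a ] U → Σ Ann (λ a' → (a ≤ₐ a') × (_ ∋ _ ∷[ a' ] _))
  look p with ⊕-rel p | ⊕∋⁻ p
  ... | refl | a₀ , q with wlook w q
  ... | a' , _ , r = rel , ≤ₐ-refl , ⊕∋ r

data WkUnder : Ctx → Ctx → Ren → Set where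
  rbase : ∀ {Δ Γ ρ} → W Δ Γ ρ → WkUnder Δ Γ ρ
  rlift : ∀ {Δ Γ ρ a a' U} → WkUnder Δ Γ ρ → a ≤ₐ a' → WkUnder (Δ ▸ (a' , ren ρ U)) (Γ ▸ (a , U)) (liftR ρ)

renLook : ∀ {Δ Γ ρ x a U} → WkUnder Δ Γ ρ → Γ ∋ x ∷[ a ] U → Σ Ann (λ a' → (a ≤ₐ a') × (Δ ∋ ρ x ∷[ a' ] ren ρ U))
renLook (rbase w) p = wlook w p
renLook (rlift {ρ = ρ} {U = U} r le) here = _ , le , ≣∋ (sym (wk-liftR ρ U)) here
renLook (rlift {ρ = ρ} r le) (there {U = U} p) with renLook r p
... | a' , le' , q = a' , le' , ≣∋ (sym (wk-liftR ρ U)) (there q)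

WkUnder⊕ : ∀ {Δ Γ ρ} → WkUnder Δ Γ ρ → WkUnder (Δ ⊕) (Γ ⊕) ρ
WkUnder⊕ (rbase w) = rbase (W⊕ w)
WkUnder⊕ (rlift r _) = rlift (WkUnder⊕ r) ≤ₐ-refl

renVar : ∀ {Δ Γ ρ x U} → WkUnder Δ Γ ρ → Γ ∋ x ∶ U → Δ ∋ ρ x ∶ ren ρ U
renVar r p with renLook r (to∷ p)
... | a' , le , q with rel≤ le
... | refl = from∷ q

mutual
  renCtx : ∀ {Δ Γ ρ} → WkUnder Δ Γ ρ → ⊢ Γ → ⊢ Δ
  renCtx (rbase w) d = wΔ w
  renCtx (rlift r _) (▸-wf d dU) = ▸-wf (renCtx r d) (renTm r dU)

  renTm : ∀ {Δ Γ ρ t T} → WkUnder Δ Γ ρ → Γ ⊢ t ∶ T → Δ ⊢ ren ρ t ∶ ren ρ T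
  renTm r (t-sort d x) = t-sort (renCtx r d) x
  renTm r (t-Π dU dT q) = t-Π (renTm r dU) (renTm (rlift r ≤ₐ-refl) dT) q
  renTm r (t-var d x) = t-var (renCtx r d) (renVar r x)
  renTm r (t-lam d dΠ) = t-lam (renTm (rlift r ≤ₐ-refl) d) (renTm r dΠ)
  renTm {ρ = ρ} r (t-app {t = t} {u = u} {T = T} d du) =
    ≣ty (sym (ren-single ρ T u)) (t-app (renTm r d) (renArg r du))
  renTm r (t-conv d e) = t-conv (renTm r d) (renTyEq r e)

  renArg : ∀ {Δ Γ ρ t a T} → WkUnder Δ Γ ρ → Γ ⊢ t ⦂[ a ] T → Δ ⊢ ren ρ t ⦂[ a ] ren ρ T
  renArg r (⦂rel d) = ⦂rel (renTm r d)
  renArg r (⦂irr d) = ⦂irr (renTm (WkUnder⊕ r) d)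

  renArgEq : ∀ {Δ Γ ρ t t' a T} → WkUnder Δ Γ ρ → Γ ⊢ t ≡ t' ⦂[ a ] T → Δ ⊢ ren ρ t ≡ ren ρ t' ⦂[ a ] ren ρ T
  renArgEq r (≡rel d) = ≡rel (renEq r d)
  renArgEq r (≡irr d d') = ≡irr (renTm (WkUnder⊕ r) d) (renTm (WkUnder⊕ r) d')

  renTyEq : ∀ {Δ Γ ρ T T'} → WkUnder Δ Γ ρ → Γ ⊢ T ≡ty T' → Δ ⊢ ren ρ T ≡ty ren ρ T'
  renTyEq r (≡ty e) = ≡ty (renEq r e)

  renEq : ∀ {Δ Γ ρ t t' T} → WkUnder Δ Γ ρ → Γ ⊢ t ≡ t' ∶ T → Δ ⊢ ren ρ t ≡ ren ρ t' ∶ ren ρ T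
  renEq {ρ = ρ} r (e-β {t = t} {T = T} {u = u} d du) =
    ≣eq refl (sym (ren-single ρ t u)) (sym (ren-single ρ T u))
      (e-β (renTm (rlift r ≤ₐ-refl) d) (renArg r du))
  renEq {ρ = ρ} r (e-η {a = a} {U = U} {t = t} d) =
    ≣eq refl (cong (λ X → lam a (ren ρ U) (app a X (var zero))) (sym (wk-liftR ρ t))) refl (e-η (renTm r d))
  renEq r (e-refl d) = e-refl (renTm r d)
  renEq r (e-sym e) = e-sym (renEq r e)
  renEq r (e-trans e e') = e-trans (renEq r e) (renEq r e')
  renEq r (e-Π e e' q) = e-Π (renEq r e) (renEq (rlift r ≤ₐ-refl) e') q
  renEq r (e-lam e d e') = e-lam (renEq r e) (renTm (rlift r ≤ₐ-refl) d) (renEq (rlift r ≤ₐ-refl) e')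
  renEq {ρ = ρ} r (e-app {u = u} {T = T} e e') =
    ≣eq refl refl (sym (ren-single ρ T u)) (e-app (renEq r e) (renArgEq r e'))
  renEq r (e-conv e e') = e-conv (renEq r e) (renTyEq r e')

wTm : ∀ {Δ Γ ρ t T} → W Δ Γ ρ → Γ ⊢ t ∶ T → Δ ⊢ ren ρ t ∶ ren ρ T
wTm w = renTm (rbase w)
wEq : ∀ {Δ Γ ρ t t' T} → W Δ Γ ρ → Γ ⊢ t ≡ t' ∶ T → Δ ⊢ ren ρ t ≡ ren ρ t' ∶ ren ρ T
wEq w = renEq (rbase w)

Wid : ∀ {Γ} → ⊢ Γ → W Γ Γ (λ n → n)
Wid d = mkW d (λ {_} {_} {U} p → _ , ≤ₐ-refl , ≣∋ (sym (ren-id U)) p)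

Wstep : ∀ {Γ b A} → ⊢ (Γ ▸ (b , A)) → W (Γ ▸ (b , A)) Γ suc
Wstep d = mkW d (λ p → _ , ≤ₐ-refl , there p)

Wres : ∀ {Γ} → ⊢ Γ → W (Γ ⊕) Γ (λ n → n)
Wres {Γ} d = mkW (⊕ctx d) (λ {_} {_} {U} p → rel , up _ , ≣∋ (sym (ren-id U)) (⊕∋ p))
  where up : ∀ a → a ≤ₐ rel
        up rel = ≤ₐ-refl
        up irr = irr≤rel

Wcomp : ∀ {Δ' Δ Γ ρ' ρ} → W Δ' Δ ρ' → W Δ Γ ρ → W Δ' Γ (ρ' ∘ ρ)
Wcomp {ρ' = ρ'} {ρ = ρ} w' w = mkW (wΔ w') look
  where
  look : ∀ {x a U} → _ ∋ x ∷[ a ] U → Σ Ann (λ a' → (a ≤ₐ a') × (_ ∋ _ ∷[ a' ] _))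
  look {U = U} p with wlook w p
  ... | a₁ , le₁ , q with wlook w' q
  ... | a₂ , le₂ , q' = a₂ , ≤ₐ-trans le₁ le₂ , ≣∋ (ren-ren ρ' ρ U) q'

wfTm : ∀ {Γ t T} → Γ ⊢ t ∶ T → ⊢ Γ
wfTm (t-sort d _) = d
wfTm (t-Π d _ _) = wfTm d
wfTm (t-var d _) = d
wfTm (t-lam _ d) = wfTm d
wfTm (t-app d _) = wfTm d
wfTm (t-conv d _) = wfTm d

invΠ : ∀ {Γ a s s' U T X} → Γ ⊢ Π a s s' U T ∶ X → (Γ ⊢ U ∶ srt s) × ((Γ ▸ (a , U)) ⊢ T ∶ srt s')
invΠ (t-Π dU dT _) = dU , dT
invΠ (t-conv d _) = invΠ d

mutual
  whnf-↘-self : ∀ {a b} → Whnf a → a ↘ b → a ≣ b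
  whnf-↘-self w (↘-whnf _) = refl
  whnf-↘-self (wh-ne (ne-app n)) (↘-app h h') with whnf-↘-self (wh-ne n) h
  ... | refl = ne-·↘ n h'

  ne-·↘ : ∀ {n ⋆ u b} → Neutral n → n ·[ ⋆ ] u ↘ b → app ⋆ n u ≣ b
  ne-·↘ () (·-β _)
  ne-·↘ n (·-ne _) = refl

mutual
  ↘-det : ∀ {t a b} → t ↘ a → t ↘ b → a ≣ b
  ↘-det (↘-whnf w) h = whnf-↘-self w h
  ↘-det h (↘-whnf w) = sym (whnf-↘-self w h)
  ↘-det (↘-app h₁ h₂) (↘-app h₁' h₂') with ↘-det h₁ h₁'
  ... | refl = ·↘-det h₂ h₂'

  ·↘-det : ∀ {f ⋆ u a b} → f ·[ ⋆ ] u ↘ a → f ·[ ⋆ ] u ↘ b → a ≣ b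
  ·↘-det (·-β h) (·-β h') = ↘-det h h'
  ·↘-det (·-β h) (·-ne ())
  ·↘-det (·-ne ()) (·-β h)
  ·↘-det (·-ne _) (·-ne _) = refl

data _⇒_ : Exp → Exp → Set where
  ⇒β   : ∀ {a U t u} → app a (lam a U t) u ⇒ (t [ u ])
  ⇒app : ∀ {a t t' u} → t ⇒ t' → app a t u ⇒ app a t' u

⇒↘ : ∀ {t t' b} → t ⇒ t' → t' ↘ b → t ↘ b
⇒↘ ⇒β h = ↘-app (↘-whnf wh-lam) (·-β h)
⇒↘ (⇒app p) (↘-whnf (wh-ne (ne-app n))) = ↘-app (⇒↘ p (↘-whnf (wh-ne n))) (·-ne n)
⇒↘ (⇒app p) (↘-app h h') = ↘-app (⇒↘ p h) h'

ren-ne : ∀ {ρ n} → Neutral n → Neutral (ren ρ n)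
ren-ne ne-var = ne-var
ren-ne (ne-app n) = ne-app (ren-ne n)

ren-whnf : ∀ {ρ a} → Whnf a → Whnf (ren ρ a)
ren-whnf wh-srt = wh-srt
ren-whnf wh-Π = wh-Π
ren-whnf wh-lam = wh-lam
ren-whnf (wh-ne n) = wh-ne (ren-ne n)

mutual
  ren-↘ : ∀ {ρ t a} → t ↘ a → ren ρ t ↘ ren ρ a
  ren-↘ (↘-whnf w) = ↘-whnf (ren-whnf w)
  ren-↘ (↘-app h h') = ↘-app (ren-↘ h) (ren-· h')

  ren-· : ∀ {ρ f ⋆ u a} → f ·[ ⋆ ] u ↘ a → ren ρ f ·[ ⋆ ] ren ρ u ↘ ren ρ a
  ren-· {ρ} (·-β {t = t} {u = u} h) = ·-β (subst (λ X → X ↘ _) (ren-single ρ t u) (ren-↘ h))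
  ren-· (·-ne n) = ·-ne (ren-ne n)

ren-⇒ : ∀ {ρ t t'} → t ⇒ t' → ren ρ t ⇒ ren ρ t'
ren-⇒ {ρ} (⇒β {a = a} {U = U} {t = t} {u = u}) =
  subst (λ X → app a (lam a (ren ρ U) (ren (liftR ρ) t)) (ren ρ u) ⇒ X) (sym (ren-single ρ t u)) ⇒β
ren-⇒ (⇒app p) = ⇒app (ren-⇒ p)

-- The logical relation

record Kit : Set₁ where
  field
    Ty   : Ctx → Exp → Sort → Set
    TyEq : ∀ {Γ A s} → Ty Γ A s → Exp → Set
    TmEq : ∀ {Γ A s} → Ty Γ A s → Exp → Exp → Set

WhNorm : Ctx → Exp → Exp → Set
WhNorm Γ t A = Σ Exp λ a → Whnf a × (t ↘ a) × (Γ ⊢ t ≡ a ∶ A)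

record Common (Γ : Ctx) (A t t' : Exp) : Set where
  constructor com
  field
    ⊢t : Γ ⊢ t ∶ A
    ⊢t' : Γ ⊢ t' ∶ A
    ⊢≡ : Γ ⊢ t ≡ t' ∶ A
    red : WhNorm Γ t A
    red' : WhNorm Γ t' A
open Common public

UEl : Kit → Ctx → ℕ → Exp → Exp → Set
UEl K Γ i t t' = Σ (Kit.Ty K Γ t (𝒮 i)) λ [t] → Kit.Ty K Γ t' (𝒮 i) × Kit.TyEq K [t] t'

w⊕ : ∀ {Δ Γ ρ} → W Δ Γ ρ → W (Δ ⊕) Γ ρ
w⊕ w = Wcomp (Wres (wΔ w)) w

argCtx : Ann → Ctx → Ctx
argCtx rel Δ = Δ
argCtx irr Δ = Δ ⊕

argW : ∀ {Δ Γ ρ} (a : Ann) → W Δ Γ ρ → W (argCtx a Δ) Γ ρ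
argW rel w = w
argW irr w = w⊕ w

-- Two irrelevant arguments of the same type are always interchangeable.
IfRel : Ann → Set → Set
IfRel rel X = X
IfRel irr X = ⊤

-- Elements of the universe Set_i, for i < l, are interpreted by the relation at level i (rec).
module LogRel (l : ℕ) (rec : ∀ {i} → i <′ l → Kit) where
  mutual
    data Ty (Γ : Ctx) (A : Exp) (s : Sort) : Set where
      Uᵣ : ∀ {i} → i <′ l → Γ ⊢ A ∶ srt s → A ↘ srt (𝒮 i) → Γ ⊢ A ≡ srt (𝒮 i) ∶ srt s → Ty Γ A s
      neᵣ : ∀ {n} → Γ ⊢ A ∶ srt s → A ↘ n → Neutral n → Γ ⊢ A ≡ n ∶ srt s → Ty Γ A s
      Πᵣ : ∀ {a s₁ s₂ U F} → Γ ⊢ A ∶ srt s → A ↘ Π a s₁ s₂ U F → Γ ⊢ A ≡ Π a s₁ s₂ U F ∶ srt s →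
           ([U] : ∀ {Δ ρ} → W Δ Γ ρ → Ty Δ (ren ρ U) s₁) →
           ([F] : ∀ {Δ ρ u} → (w : W Δ Γ ρ) → Arg a [U] w u → Ty Δ ((ren (liftR ρ) F) [ u ]) s₂) →
           (∀ {Δ ρ u u'} (w : W Δ Γ ρ) (du : Arg a [U] w u) → Arg a [U] w u' → ArgEq a [U] w u u' →
               TyEq ([F] w du) ((ren (liftR ρ) F) [ u' ])) →
           Ty Γ A s

    Arg : ∀ {Γ U s₁} (a : Ann) → (∀ {Δ ρ} → W Δ Γ ρ → Ty Δ (ren ρ U) s₁) → ∀ {Δ ρ} → W Δ Γ ρ → Exp → Set
    Arg a [U] w u = TmEq ([U] (argW a w)) u u

    ArgEq : ∀ {Γ U s₁} (a : Ann) → (∀ {Δ ρ} → W Δ Γ ρ → Ty Δ (ren ρ U) s₁) → ∀ {Δ ρ} → W Δ Γ ρ → Exp → Exp → Set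
    ArgEq a [U] w u u' = IfRel a (TmEq ([U] (argW a w)) u u')

    TyEq : ∀ {Γ A s} → Ty Γ A s → Exp → Set
    TyEq {Γ} {A} {s} (Uᵣ {i} p _ _ _) B = Γ ⊢ B ∶ srt s × B ↘ srt (𝒮 i) × Γ ⊢ A ≡ B ∶ srt s
    TyEq {Γ} {A} {s} (neᵣ _ _ _ _) B = Γ ⊢ B ∶ srt s × Σ Exp (λ n' → (B ↘ n') × Neutral n') × Γ ⊢ A ≡ B ∶ srt s
    TyEq {Γ} {A} {s} (Πᵣ {a} {s₁} {s₂} {U} {F} _ _ _ [U] [F] _) B =
      Γ ⊢ B ∶ srt s × Γ ⊢ A ≡ B ∶ srt s × Σ Exp λ U' → Σ Exp λ F' → (B ↘ Π a s₁ s₂ U' F') ×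
        (∀ {Δ ρ} (w : W Δ Γ ρ) → TyEq ([U] w) (ren ρ U')) ×
        (∀ {Δ ρ u} (w : W Δ Γ ρ) (du : Arg a [U] w u) → TyEq ([F] w du) ((ren (liftR ρ) F') [ u ]))

    TmEq : ∀ {Γ A s} → Ty Γ A s → Exp → Exp → Set
    TmEq {Γ} {A} (Uᵣ {i} p _ _ _) t t' = Common Γ A t t' × UEl (rec p) Γ i t t'
    TmEq {Γ} {A} (neᵣ _ _ _ _) t t' = Common Γ A t t'
    TmEq {Γ} {A} (Πᵣ {a} _ _ _ [U] [F] _) t t' = Common Γ A t t' ×
      (∀ {Δ ρ u u'} (w : W Δ Γ ρ) (du : Arg a [U] w u) (du' : Arg a [U] w u') → ArgEq a [U] w u u' →
         TmEq ([F] w du) (app a (ren ρ t) u) (app a (ren ρ t') u'))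

open LogRel public

kitOf : (l : ℕ) → (∀ {i} → i <′ l → Kit) → Kit
kitOf l r = record { Ty = Ty l r ; TyEq = TyEq l r ; TmEq = TmEq l r }

mutual
  levelKit : ℕ → Kit
  levelKit l = kitOf l (lowerKit l)

  lowerKit : ∀ l {i} → i <′ l → Kit
  lowerKit (suc l) ≤′-refl = levelKit l
  lowerKit (suc l) (≤′-step p) = lowerKit l p

lowerKit≡ : ∀ l {i} (p : i <′ l) → lowerKit l p ≣ levelKit i
lowerKit≡ (suc l) ≤′-refl = refl
lowerKit≡ (suc l) (≤′-step p) = lowerKit≡ l p

⊩ : ℕ → Ctx → Exp → Sort → Set
⊩ l = Ty l (lowerKit l)

⊩Eq : ∀ {l Γ A s} → ⊩ l Γ A s → Exp → Set
⊩Eq {l} = TyEq l (lowerKit l)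

⊩Tm : ∀ {l Γ A s} → ⊩ l Γ A s → Exp → Exp → Set
⊩Tm {l} = TmEq l (lowerKit l)

⊩Dom : ℕ → Ctx → Exp → Sort → Set
⊩Dom l Γ U s₁ = ∀ {Δ ρ} → W Δ Γ ρ → ⊩ l Δ (ren ρ U) s₁

⊩Cod : ∀ {l Γ U s₁} → Ann → ⊩Dom l Γ U s₁ → Exp → Sort → Set
⊩Cod {l} {Γ} a [U] F s₂ = ∀ {Δ ρ u} (w : W Δ Γ ρ) → Arg l (lowerKit l) a [U] w u → ⊩ l Δ ((ren (liftR ρ) F) [ u ]) s₂

⊩CodExt : ∀ {l Γ U s₁ s₂} (a : Ann) ([U] : ⊩Dom l Γ U s₁) (F : Exp) → ⊩Cod a [U] F s₂ → Set
⊩CodExt {l} {Γ} a [U] F [F] = ∀ {Δ ρ u u'} (w : W Δ Γ ρ) (du : Arg l (lowerKit l) a [U] w u) →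
  Arg l (lowerKit l) a [U] w u' → ArgEq l (lowerKit l) a [U] w u u' → ⊩Eq ([F] w du) ((ren (liftR ρ) F) [ u' ])

srt-Π-clash : ∀ {B s a s₁ s₂ U F} → B ↘ srt s → B ↘ Π a s₁ s₂ U F → ⊥
srt-Π-clash h h' with ↘-det h h'
... | ()
srt-ne-clash : ∀ {B s n} → B ↘ srt s → B ↘ n → Neutral n → ⊥
srt-ne-clash h h' n with ↘-det h h'
srt-ne-clash h h' () | refl
Π-ne-clash : ∀ {B a s₁ s₂ U F n} → B ↘ Π a s₁ s₂ U F → B ↘ n → Neutral n → ⊥
Π-ne-clash h h' n with ↘-det h h'
Π-ne-clash h h' () | refl

toKit : ∀ {l i Γ t t'} (p : i <′ l) → UEl (lowerKit l p) Γ i t t' → UEl (levelKit i) Γ i t t'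
toKit {l} p x = subst (λ K → UEl K _ _ _ _) (lowerKit≡ l p) x

fromKit : ∀ {l i Γ t t'} (p : i <′ l) → UEl (levelKit i) Γ i t t' → UEl (lowerKit l p) Γ i t t'
fromKit {l} p x = subst (λ K → UEl K _ _ _ _) (sym (lowerKit≡ l p)) x

⊩⇒⊢ : ∀ {l Γ A s} → ⊩ l Γ A s → Γ ⊢ A ∶ srt s
⊩⇒⊢ (Uᵣ _ d _ _) = d
⊩⇒⊢ (neᵣ d _ _ _) = d
⊩⇒⊢ (Πᵣ d _ _ _ _ _) = d

⊩Eq⇒⊢≡ : ∀ {l Γ A s B} ([A] : ⊩ l Γ A s) → ⊩Eq [A] B → Γ ⊢ A ≡ B ∶ srt s
⊩Eq⇒⊢≡ (Uᵣ _ _ _ _) (_ , _ , e) = e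
⊩Eq⇒⊢≡ (neᵣ _ _ _ _) (_ , _ , e) = e
⊩Eq⇒⊢≡ (Πᵣ _ _ _ _ _ _) (_ , e , _) = e

⊩Tm⇒common : ∀ {l Γ A s t t'} ([A] : ⊩ l Γ A s) → ⊩Tm [A] t t' → Common Γ A t t'
⊩Tm⇒common (Uᵣ _ _ _ _) (c , _) = c
⊩Tm⇒common (neᵣ _ _ _ _) c = c
⊩Tm⇒common (Πᵣ _ _ _ _ _ _) (c , _) = c

whNormConv : ∀ {Γ t A B} → WhNorm Γ t A → Γ ⊢ A ≡ty B → WhNorm Γ t B
whNormConv (a , w , h , e) q = a , w , h , e-conv e q

comConv : ∀ {Γ A B t t'} → Common Γ A t t' → Γ ⊢ A ≡ty B → Common Γ B t t'
comConv (com d d' e r r') q = com (t-conv d q) (t-conv d' q) (e-conv e q) (whNormConv r q) (whNormConv r' q)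

comSym : ∀ {Γ A t t'} → Common Γ A t t' → Common Γ A t' t
comSym (com d d' e r r') = com d' d (e-sym e) r' r

comTrans : ∀ {Γ A t t' t''} → Common Γ A t t' → Common Γ A t' t'' → Common Γ A t t''
comTrans (com d d' e r r') (com _ d'' e' _ r'') = com d d'' (e-trans e e') r r''

mapIfRel : ∀ a {X Y : Set} → (X → Y) → IfRel a X → IfRel a Y
mapIfRel rel f x = f x
mapIfRel irr f x = tt

ifRel : ∀ a {X : Set} → X → IfRel a X
ifRel rel x = x
ifRel irr x = tt

data ShapeView {l l' Γ A B s s'} : ([A] : ⊩ l Γ A s) ([B] : ⊩ l' Γ B s') → ⊩Eq [A] B → Set where
  Uᵥ  : ∀ {i p p' dA hA eA dB hB eB dB' hB' eAB} →
        ShapeView (Uᵣ {i = i} p dA hA eA) (Uᵣ {i = i} p' dB hB eB) (dB' , hB' , eAB)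
  neᵥ : ∀ {n n' dA hA nA eA dB hB nB eB dB' r eAB} →
        ShapeView (neᵣ {n = n} dA hA nA eA) (neᵣ {n = n'} dB hB nB eB) (dB' , r , eAB)
  Πᵥ  : ∀ {a s₁ s₂ U F U' F' dA hA eA dB hB eB}
          {[U] : ⊩Dom l Γ U s₁} {[F] : ⊩Cod a [U] F s₂} {[F≡] : ⊩CodExt a [U] F [F]}
          {[U'] : ⊩Dom l' Γ U' s₁} {[F'] : ⊩Cod a [U'] F' s₂} {[F≡'] : ⊩CodExt a [U'] F' [F']}
          {dB' eAB hB' eqUF} →
        ShapeView (Πᵣ {a = a} {s₁} {s₂} {U} {F} dA hA eA [U] [F] [F≡])
                  (Πᵣ {a = a} {s₁} {s₂} {U'} {F'} dB hB eB [U'] [F'] [F≡'])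
                  (dB' , eAB , U' , F' , hB' , eqUF)

shapeView : ∀ {l l' Γ A B s s'} ([A] : ⊩ l Γ A s) ([B] : ⊩ l' Γ B s') (e : ⊩Eq [A] B) → ShapeView [A] [B] e
shapeView (Uᵣ _ _ _ _) (Uᵣ _ _ hB _) (_ , h , _) with ↘-det h hB
... | refl = Uᵥ
shapeView (Uᵣ _ _ _ _) (neᵣ _ hB nB _) (_ , h , _) = ⊥-elim (srt-ne-clash h hB nB)
shapeView (Uᵣ _ _ _ _) (Πᵣ _ hB _ _ _ _) (_ , h , _) = ⊥-elim (srt-Π-clash h hB)
shapeView (neᵣ _ _ _ _) (Uᵣ _ _ hB _) (_ , (_ , h , n) , _) = ⊥-elim (srt-ne-clash hB h n)
shapeView (neᵣ _ _ _ _) (neᵣ _ _ _ _) (_ , _ , _) = neᵥ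
shapeView (neᵣ _ _ _ _) (Πᵣ _ hB _ _ _ _) (_ , (_ , h , n) , _) = ⊥-elim (Π-ne-clash hB h n)
shapeView (Πᵣ _ _ _ _ _ _) (Uᵣ _ _ hB _) (_ , _ , _ , _ , h , _) = ⊥-elim (srt-Π-clash hB h)
shapeView (Πᵣ _ _ _ _ _ _) (neᵣ _ hB nB _) (_ , _ , _ , _ , h , _) = ⊥-elim (Π-ne-clash h hB nB)
shapeView (Πᵣ _ _ _ _ _ _) (Πᵣ _ hB _ _ _ _) (_ , _ , _ , _ , h , _) with ↘-det h hB
... | refl = Πᵥ

mutual
  convTm : ∀ {l l' Γ A B s s' t t'} ([A] : ⊩ l Γ A s) ([B] : ⊩ l' Γ B s') → ⊩Eq [A] B → ⊩Tm [A] t t' → ⊩Tm [B] t t'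
  convTm [A] [B] e x with shapeView [A] [B] e
  convTm (Uᵣ p _ _ _) (Uᵣ p' _ _ _) (_ , _ , eAB) (c , ue) | Uᵥ = comConv c (≡ty eAB) , fromKit p' (toKit p ue)
  convTm (neᵣ _ _ _ _) (neᵣ _ _ _ _) (_ , _ , eAB) c | neᵥ = comConv c (≡ty eAB)
  convTm (Πᵣ {a} _ _ _ [U] [F] _) (Πᵣ _ _ _ [U'] [F'] _) (_ , eAB , _ , _ , _ , eqU , eqF) (c , f) | Πᵥ =
    comConv c (≡ty eAB) , λ w du' du'' e' →
      let du  = convTm⁻ ([U] (argW a w)) ([U'] (argW a w)) (eqU (argW a w)) du'
          du2 = convTm⁻ ([U] (argW a w)) ([U'] (argW a w)) (eqU (argW a w)) du''
          e   = mapIfRel a (convTm⁻ ([U] (argW a w)) ([U'] (argW a w)) (eqU (argW a w))) e'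
      in convTm ([F] w du) ([F'] w du') (eqF w du) (f w du du2 e)

  convTm⁻ : ∀ {l l' Γ A B s s' t t'} ([A] : ⊩ l Γ A s) ([B] : ⊩ l' Γ B s') → ⊩Eq [A] B → ⊩Tm [B] t t' →
            ⊩Tm [A] t t'
  convTm⁻ [A] [B] e x with shapeView [A] [B] e
  convTm⁻ (Uᵣ p _ _ _) (Uᵣ p' _ _ _) (_ , _ , eAB) (c , ue) | Uᵥ = comConv c (≡ty (e-sym eAB)) , fromKit p (toKit p' ue)
  convTm⁻ (neᵣ _ _ _ _) (neᵣ _ _ _ _) (_ , _ , eAB) c | neᵥ = comConv c (≡ty (e-sym eAB))
  convTm⁻ (Πᵣ {a} _ _ _ [U] [F] _) (Πᵣ _ _ _ [U'] [F'] _) (_ , eAB , _ , _ , _ , eqU , eqF) (c , f) | Πᵥ =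
    comConv c (≡ty (e-sym eAB)) , λ w du du2 e →
      let du'  = convTm ([U] (argW a w)) ([U'] (argW a w)) (eqU (argW a w)) du
          du2' = convTm ([U] (argW a w)) ([U'] (argW a w)) (eqU (argW a w)) du2
          e'   = mapIfRel a (convTm ([U] (argW a w)) ([U'] (argW a w)) (eqU (argW a w))) e
      in convTm⁻ ([F] w du) ([F'] w du') (eqF w du) (f w du' du2' e')

reflTy : ∀ {l Γ A s} ([A] : ⊩ l Γ A s) → ⊩Eq [A] A
reflTy (Uᵣ p d h e) = d , h , e-refl d
reflTy (neᵣ d h n e) = d , (_ , h , n) , e-refl d
reflTy (Πᵣ {U = U} {F = F} d h e [U] [F] _) = d , e-refl d , U , F , h , (λ w → reflTy ([U] w)) , (λ w du → reflTy ([F] w du))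

symTy : ∀ {l l' Γ A B s} ([A] : ⊩ l Γ A s) ([B] : ⊩ l' Γ B s) → ⊩Eq [A] B → ⊩Eq [B] A
symTy [A] [B] e with shapeView [A] [B] e
symTy (Uᵣ _ dA hA _) (Uᵣ _ _ _ _) (_ , _ , eAB) | Uᵥ = dA , hA , e-sym eAB
symTy (neᵣ dA hA nA _) (neᵣ _ _ _ _) (_ , _ , eAB) | neᵥ = dA , (_ , hA , nA) , e-sym eAB
symTy (Πᵣ {a} {U = U} {F = F} dA hA _ [U] [F] _) (Πᵣ _ _ _ [U'] [F'] _) (_ , eAB , _ , _ , _ , eqU , eqF) | Πᵥ =
  dA , e-sym eAB , U , F , hA , (λ w → symTy ([U] w) ([U'] w) (eqU w)) ,
  λ w du' → let du = convTm⁻ ([U] (argW a w)) ([U'] (argW a w)) (eqU (argW a w)) du'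
            in symTy ([F] w du) ([F'] w du') (eqF w du)

transTy : ∀ {l l' Γ A B C s} ([A] : ⊩ l Γ A s) ([B] : ⊩ l' Γ B s) → ⊩Eq [A] B → ⊩Eq [B] C → ⊩Eq [A] C
transTy [A] [B] e e' with shapeView [A] [B] e
transTy (Uᵣ _ _ _ _) (Uᵣ _ _ _ _) (_ , _ , eAB) (dC , hC , eBC) | Uᵥ = dC , hC , e-trans eAB eBC
transTy (neᵣ _ _ _ _) (neᵣ _ _ _ _) (_ , _ , eAB) (dC , nC , eBC) | neᵥ = dC , nC , e-trans eAB eBC
transTy (Πᵣ {a} _ _ _ [U] [F] _) (Πᵣ _ _ _ [U'] [F'] _) (_ , eAB , _ , _ , _ , eqU , eqF)
        (dC , eBC , U'' , F'' , hC , eqU' , eqF') | Πᵥ =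
  dC , e-trans eAB eBC , U'' , F'' , hC , (λ w → transTy ([U] w) ([U'] w) (eqU w) (eqU' w)) ,
  λ w du → let du' = convTm ([U] (argW a w)) ([U'] (argW a w)) (eqU (argW a w)) du
           in transTy ([F] w du) ([F'] w du') (eqF w du) (eqF' w du')

symU : ∀ {i Γ t t'} → UEl (levelKit i) Γ i t t' → UEl (levelKit i) Γ i t' t
symU ([t] , [t'] , e) = [t'] , [t] , symTy [t] [t'] e

transU : ∀ {i Γ t t' t''} → UEl (levelKit i) Γ i t t' → UEl (levelKit i) Γ i t' t'' → UEl (levelKit i) Γ i t t''
transU ([t] , [t'] , e) ([t']₂ , [t''] , e') = [t] , [t''] , transTy [t] [t']₂ e e'

symTm : ∀ {l Γ A s t t'} ([A] : ⊩ l Γ A s) → ⊩Tm [A] t t' → ⊩Tm [A] t' t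
symTm (Uᵣ p _ _ _) (c , ue) = comSym c , fromKit p (symU (toKit p ue))
symTm (neᵣ _ _ _ _) c = comSym c
symTm (Πᵣ {a} _ _ _ [U] [F] [F≡]) (c , f) = comSym c , λ w du du' e →
  let e' = mapIfRel a (symTm ([U] (argW a w))) e
  in convTm ([F] w du') ([F] w du) ([F≡] w du' du e') (symTm ([F] w du') (f w du' du e'))

transTm : ∀ {l Γ A s t t' t''} ([A] : ⊩ l Γ A s) → ⊩Tm [A] t t' → ⊩Tm [A] t' t'' → ⊩Tm [A] t t''
transTm (Uᵣ p _ _ _) (c , ue) (c' , ue') = comTrans c c' , fromKit p (transU (toKit p ue) (toKit p ue'))
transTm (neᵣ _ _ _ _) c c' = comTrans c c'
transTm (Πᵣ {a} _ _ _ [U] [F] [F≡]) (c , f) (c' , g) = comTrans c c' , λ w du du' e →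
  let x  = f w du du' e
      y  = g w du' du' (ifRel a du')
      e' = mapIfRel a (symTm ([U] (argW a w))) e
  in transTm ([F] w du) x (convTm ([F] w du') ([F] w du) ([F≡] w du' du e') y)

irrTm : ∀ {l l' Γ A s s' t t'} ([A] : ⊩ l Γ A s) ([A'] : ⊩ l' Γ A s') → ⊩Tm [A] t t' → ⊩Tm [A'] t t'
irrTm [A] [A'] = convTm [A] [A'] (reflTy [A])

irrEq : ∀ {l l' Γ A s B} ([A] : ⊩ l Γ A s) ([A'] : ⊩ l' Γ A s) → ⊩Eq [A] B → ⊩Eq [A'] B
irrEq [A] [A'] e = transTy [A'] [A] (symTy [A] [A'] (reflTy [A])) e

castTy : ∀ {l Γ A A' s} → A ≣ A' → ⊩ l Γ A s → ⊩ l Γ A' s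
castTy refl x = x

castTm : ∀ {l Γ A A' s t t'} (e : A ≣ A') ([A] : ⊩ l Γ A s) → ⊩Tm [A] t t' → ⊩Tm (castTy e [A]) t t'
castTm refl _ x = x

castTm⁻ : ∀ {l Γ A A' s t t'} (e : A ≣ A') ([A] : ⊩ l Γ A s) → ⊩Tm (castTy e [A]) t t' → ⊩Tm [A] t t'
castTm⁻ refl _ x = x

castEq : ∀ {l Γ A A' s B B'} (e : A ≣ A') ([A] : ⊩ l Γ A s) → ⊩Eq [A] B → B ≣ B' → ⊩Eq (castTy e [A]) B'
castEq refl _ x refl = x

≣Tm : ∀ {l Γ A s t t' u u'} ([A] : ⊩ l Γ A s) → t ≣ u → t' ≣ u' → ⊩Tm [A] t t' → ⊩Tm [A] u u'
≣Tm _ refl refl x = x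

⊢arg : ∀ {Δ u U} a → argCtx a Δ ⊢ u ∶ U → Δ ⊢ u ⦂[ a ] U
⊢arg rel d = ⦂rel d
⊢arg irr d = ⦂irr d

⊢argEq : ∀ {l Δ u u' U s} a ([X] : ⊩ l (argCtx a Δ) U s) → ⊩Tm [X] u u → ⊩Tm [X] u' u' → IfRel a (⊩Tm [X] u u') →
         Δ ⊢ u ≡ u' ⦂[ a ] U
⊢argEq rel [X] du du' e = ≡rel (⊢≡ (⊩Tm⇒common [X] e))
⊢argEq irr [X] du du' e = ≡irr (⊢t (⊩Tm⇒common [X] du)) (⊢t (⊩Tm⇒common [X] du'))

wkWhNorm : ∀ {Δ Γ ρ t A} → W Δ Γ ρ → WhNorm Γ t A → WhNorm Δ (ren ρ t) (ren ρ A)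
wkWhNorm w (a , wa , h , e) = ren _ a , ren-whnf wa , ren-↘ h , wEq w e

wkCom : ∀ {Δ Γ ρ A t t'} → W Δ Γ ρ → Common Γ A t t' → Common Δ (ren ρ A) (ren ρ t) (ren ρ t')
wkCom w (com d d' e r r') = com (wTm w d) (wTm w d') (wEq w e) (wkWhNorm w r) (wkWhNorm w r')

module WkΠ {l Γ Δ ρ s₁ s₂ U F a} (w : W Δ Γ ρ) ([U] : ⊩Dom l Γ U s₁) ([F] : ⊩Cod a [U] F s₂) where
  wkΠU : ⊩Dom l Δ (ren ρ U) s₁
  wkΠU {ρ = ρ'} w' = castTy (sym (ren-ren ρ' ρ U)) ([U] (Wcomp w' w))

  wkArg : ∀ {Δ' ρ' u} (w' : W Δ' Δ ρ') → Arg l (lowerKit l) a wkΠU w' u → Arg l (lowerKit l) a [U] (Wcomp w' w) u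
  wkArg {ρ' = ρ'} w' du' = irrTm ([U] (Wcomp (argW a w') w)) ([U] (argW a (Wcomp w' w)))
                             (castTm⁻ (sym (ren-ren ρ' ρ U)) ([U] (Wcomp (argW a w') w)) du')

  wkArgEq : ∀ {Δ' ρ' u u'} (w' : W Δ' Δ ρ') → ArgEq l (lowerKit l) a wkΠU w' u u' →
            ArgEq l (lowerKit l) a [U] (Wcomp w' w) u u'
  wkArgEq {ρ' = ρ'} w' = mapIfRel a (λ x → irrTm ([U] (Wcomp (argW a w') w)) ([U] (argW a (Wcomp w' w)))
                           (castTm⁻ (sym (ren-ren ρ' ρ U)) ([U] (Wcomp (argW a w') w)) x))

  wkΠF : ⊩Cod a wkΠU (ren (liftR ρ) F) s₂
  wkΠF {ρ = ρ'} {u = u} w' du' = castTy (cong (_[ u ]) (sym (ren-ren-liftR ρ' ρ F))) ([F] (Wcomp w' w) (wkArg w' du'))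

wkTy : ∀ {l Δ Γ ρ A s} → W Δ Γ ρ → ⊩ l Γ A s → ⊩ l Δ (ren ρ A) s
wkTy w (Uᵣ p d h e) = Uᵣ p (wTm w d) (ren-↘ h) (wEq w e)
wkTy w (neᵣ d h n e) = neᵣ (wTm w d) (ren-↘ h) (ren-ne n) (wEq w e)
wkTy {ρ = ρ} w (Πᵣ {a} {U = U} {F = F} d h e [U] [F] [F≡]) =
  Πᵣ (wTm w d) (ren-↘ h) (wEq w e) wkΠU wkΠF λ {_} {ρ'} {u} {u'} w' du' du2' e' →
    castEq (cong (_[ u ]) (sym (ren-ren-liftR ρ' ρ F))) ([F] (Wcomp w' w) (wkArg w' du'))
      ([F≡] (Wcomp w' w) (wkArg w' du') (wkArg w' du2') (wkArgEq w' e'))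
      (cong (_[ u' ]) (sym (ren-ren-liftR ρ' ρ F)))
  where open WkΠ {U = U} {F = F} {a = a} w [U] [F]

wkEq : ∀ {l Δ Γ ρ A s B} (w : W Δ Γ ρ) ([A] : ⊩ l Γ A s) → ⊩Eq [A] B → ⊩Eq (wkTy w [A]) (ren ρ B)
wkEq w (Uᵣ p d h e) (dB , hB , eAB) = wTm w dB , ren-↘ hB , wEq w eAB
wkEq w (neᵣ d h n e) (dB , (n' , hB , nB) , eAB) = wTm w dB , (_ , ren-↘ hB , ren-ne nB) , wEq w eAB
wkEq {ρ = ρ} w (Πᵣ {a} {U = U} {F = F} d h e [U] [F] [F≡]) (dB , eAB , U' , F' , hB , eqU , eqF) =
  wTm w dB , wEq w eAB , ren ρ U' , ren (liftR ρ) F' , ren-↘ hB ,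
  (λ {_} {ρ'} w' → castEq (sym (ren-ren ρ' ρ U)) ([U] (Wcomp w' w)) (eqU (Wcomp w' w)) (sym (ren-ren ρ' ρ U'))) ,
  (λ {_} {ρ'} {u} w' du' → castEq (cong (_[ u ]) (sym (ren-ren-liftR ρ' ρ F))) ([F] (Wcomp w' w) (wkArg w' du'))
       (eqF (Wcomp w' w) (wkArg w' du')) (cong (_[ u ]) (sym (ren-ren-liftR ρ' ρ F'))))
  where open WkΠ {U = U} {F = F} {a = a} w [U] [F]

wkU : ∀ {i Δ Γ ρ t t'} → W Δ Γ ρ → UEl (levelKit i) Γ i t t' → UEl (levelKit i) Δ i (ren ρ t) (ren ρ t')
wkU w ([t] , [t'] , e) = wkTy w [t] , wkTy w [t'] , wkEq w [t] e

wkTm : ∀ {l Δ Γ ρ A s t t'} (w : W Δ Γ ρ) ([A] : ⊩ l Γ A s) → ⊩Tm [A] t t' → ⊩Tm (wkTy w [A]) (ren ρ t) (ren ρ t')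
wkTm w (Uᵣ p d h e) (c , ue) = wkCom w c , fromKit p (wkU w (toKit p ue))
wkTm w (neᵣ d h n e) c = wkCom w c
wkTm {ρ = ρ} {t = t} {t' = t'} w (Πᵣ {a} {U = U} {F = F} d h e [U] [F] [F≡]) (c , f) =
  wkCom w c , λ {_} {ρ'} {u} {u'} w' du' du2' e' →
    castTm (cong (_[ u ]) (sym (ren-ren-liftR ρ' ρ F))) ([F] (Wcomp w' w) (wkArg w' du'))
      (≣Tm ([F] (Wcomp w' w) (wkArg w' du'))
           (cong (λ X → app a X u) (sym (ren-ren ρ' ρ t))) (cong (λ X → app a X u') (sym (ren-ren ρ' ρ t')))
           (f (Wcomp w' w) (wkArg w' du') (wkArg w' du2') (wkArgEq w' e')))
  where open WkΠ {U = U} {F = F} {a = a} w [U] [F]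

module _ {l Γ A s a s₁ s₂ U F} (dA : Γ ⊢ A ≡ Π a s₁ s₂ U F ∶ srt s) ([U] : ⊩Dom l Γ U s₁) where
  appTy : ∀ {Δ ρ t u} (w : W Δ Γ ρ) → Γ ⊢ t ∶ A → Arg l (lowerKit l) a [U] w u →
          Δ ⊢ app a (ren ρ t) u ∶ (ren (liftR ρ) F) [ u ]
  appTy w dt du = t-app (t-conv (wTm w dt) (≡ty (wEq w dA))) (⊢arg a (⊢t (⊩Tm⇒common ([U] (argW a w)) du)))

  appEq : ∀ {Δ ρ t t' u u'} (w : W Δ Γ ρ) → Γ ⊢ t ≡ t' ∶ A → Arg l (lowerKit l) a [U] w u →
          Arg l (lowerKit l) a [U] w u' →
          ArgEq l (lowerKit l) a [U] w u u' → Δ ⊢ app a (ren ρ t) u ≡ app a (ren ρ t') u' ∶ (ren (liftR ρ) F) [ u ]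
  appEq w e du du' e' = e-app (e-conv (wEq w e) (≡ty (wEq w dA))) (⊢argEq a ([U] (argW a w)) du du' e')

neWhNorm : ∀ {Γ n A} → Neutral n → Γ ⊢ n ∶ A → WhNorm Γ n A
neWhNorm ne d = _ , wh-ne ne , ↘-whnf (wh-ne ne) , e-refl d

reflNe : ∀ {l Γ A s n n'} ([A] : ⊩ l Γ A s) → Neutral n → Neutral n' →
         Γ ⊢ n ∶ A → Γ ⊢ n' ∶ A → Γ ⊢ n ≡ n' ∶ A → ⊩Tm [A] n n'
reflNe (Uᵣ {i} p dA hA eA) ne ne' d d' e =
  com d d' e (neWhNorm ne d) (neWhNorm ne' d') ,
  fromKit p (neᵣ dU (↘-whnf (wh-ne ne)) ne (e-refl dU) , neᵣ dU' (↘-whnf (wh-ne ne')) ne' (e-refl dU') ,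
             (dU' , (_ , ↘-whnf (wh-ne ne') , ne') , e-conv e (≡ty eA)))
  where dU = t-conv d (≡ty eA)
        dU' = t-conv d' (≡ty eA)
reflNe (neᵣ _ _ _ _) ne ne' d d' e = com d d' e (neWhNorm ne d) (neWhNorm ne' d')
reflNe (Πᵣ {a} dA hA eA [U] [F] [F≡]) ne ne' d d' e =
  com d d' e (neWhNorm ne d) (neWhNorm ne' d') , λ w du du' e' →
    let e'' = mapIfRel a (symTm ([U] (argW a w))) e'
    in reflNe ([F] w du) (ne-app (ren-ne ne)) (ne-app (ren-ne ne'))
         (appTy eA [U] w d du)
         (t-conv (appTy eA [U] w d' du') (≡ty (⊩Eq⇒⊢≡ ([F] w du') ([F≡] w du' du e''))))
         (appEq eA [U] w e du du' e')

expTy : ∀ {l Γ B B₁ s} → ⊩ l Γ B₁ s → B ⇒ B₁ → Γ ⊢ B ∶ srt s → Γ ⊢ B ≡ B₁ ∶ srt s → ⊩ l Γ B s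
expTy (Uᵣ p d h e) st dB eB = Uᵣ p dB (⇒↘ st h) (e-trans eB e)
expTy (neᵣ d h n e) st dB eB = neᵣ dB (⇒↘ st h) n (e-trans eB e)
expTy (Πᵣ d h e [U] [F] [F≡]) st dB eB = Πᵣ dB (⇒↘ st h) (e-trans eB e) [U] [F] [F≡]

expTyEq : ∀ {l Γ B B₁ s C} ([B] : ⊩ l Γ B₁ s) (st : B ⇒ B₁) (dB : Γ ⊢ B ∶ srt s) (eB : Γ ⊢ B ≡ B₁ ∶ srt s) →
          ⊩Eq [B] C → ⊩Eq (expTy [B] st dB eB) C
expTyEq (Uᵣ p d h e) st dB eB (dC , hC , e') = dC , hC , e-trans eB e'
expTyEq (neᵣ d h n e) st dB eB (dC , nC , e') = dC , nC , e-trans eB e'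
expTyEq (Πᵣ d h e [U] [F] [F≡]) st dB eB (dC , e' , rest) = dC , e-trans eB e' , rest

expCom : ∀ {Γ A t t₁ t'} → t ⇒ t₁ → Γ ⊢ t ∶ A → Γ ⊢ t ≡ t₁ ∶ A → Common Γ A t₁ t' → Common Γ A t t'
expCom st dt et (com d d' e (a , wa , h , ea) r') = com dt d' (e-trans et e) (a , wa , ⇒↘ st h , e-trans et ea) r'

expU : ∀ {i Γ t t₁ t'} → t ⇒ t₁ → Γ ⊢ t ∶ srt (𝒮 i) → Γ ⊢ t ≡ t₁ ∶ srt (𝒮 i) → UEl (levelKit i) Γ i t₁ t' →
       UEl (levelKit i) Γ i t t'
expU st dt et ([t₁] , [t'] , eq) = expTy [t₁] st dt et , [t'] , expTyEq [t₁] st dt et eq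

expTm : ∀ {l Γ A s t t₁ t'} ([A] : ⊩ l Γ A s) → t ⇒ t₁ → Γ ⊢ t ∶ A → Γ ⊢ t ≡ t₁ ∶ A → ⊩Tm [A] t₁ t' → ⊩Tm [A] t t'
expTm (Uᵣ p dA hA eA) st dt et (c , ue) =
  expCom st dt et c , fromKit p (expU st (t-conv dt (≡ty eA)) (e-conv et (≡ty eA)) (toKit p ue))
expTm (neᵣ _ _ _ _) st dt et c = expCom st dt et c
expTm (Πᵣ {a} dA hA eA [U] [F] [F≡]) st dt et (c , f) =
  expCom st dt et c , λ w du du' e' →
    expTm ([F] w du) (⇒app (ren-⇒ st)) (appTy eA [U] w dt du)
      (appEq eA [U] w et du du (ifRel a du)) (f w du du' e')

liftTy : ∀ {i l Γ A s} → i ≤′ l → ⊩ i Γ A s → ⊩ l Γ A s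
liftTy le (Uᵣ p d h e) = Uᵣ (≤′-trans p le) d h e
liftTy le (neᵣ d h n e) = neᵣ d h n e
liftTy le (Πᵣ {a} d h e [U] [F] [F≡]) =
  Πᵣ d h e (λ w → liftTy le ([U] w))
    (λ w du → liftTy le ([F] w (irrTm (liftTy le ([U] (argW a w))) ([U] (argW a w)) du)))
    (λ w du du' e' →
      let du₀ = irrTm (liftTy le ([U] (argW a w))) ([U] (argW a w)) du
          du₀' = irrTm (liftTy le ([U] (argW a w))) ([U] (argW a w)) du'
          e₀ = mapIfRel a (irrTm (liftTy le ([U] (argW a w))) ([U] (argW a w))) e'
      in irrEq ([F] w du₀) (liftTy le ([F] w du₀)) ([F≡] w du₀ du₀' e₀))

toArg : ∀ a {l Δ X s} → ⊩ l Δ X s → ⊩ l (argCtx a Δ) X s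
toArg rel x = x
toArg irr {X = X} x = castTy (ren-id X) (wkTy (Wres (wfTm (⊩⇒⊢ x))) x)

toArgTm : ∀ a {l Δ X s t t'} ([X] : ⊩ l Δ X s) → ⊩Tm [X] t t' → ⊩Tm (toArg a [X]) t t'
toArgTm rel [X] e = e
toArgTm irr {X = X} {t = t} {t' = t'} [X] e =
  castTm (ren-id X) (wkTy (Wres (wfTm (⊩⇒⊢ [X]))) [X])
    (≣Tm (wkTy (Wres (wfTm (⊩⇒⊢ [X]))) [X]) (ren-id t) (ren-id t') (wkTm (Wres (wfTm (⊩⇒⊢ [X]))) [X] e))

W-argCtx : ∀ a {Δ' Δ ρ} → W Δ' Δ ρ → W (argCtx a Δ') (argCtx a Δ) ρ
W-argCtx rel w = w
W-argCtx irr w = W⊕ w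

-- Validity

RedArg : Ann → Ctx → Exp → Exp → Set
RedArg a Δ A t = Σ ℕ λ l → Σ Sort λ s → Σ (⊩ l (argCtx a Δ) A s) λ [A] → ⊩Tm [A] t t

RedArgEq : Ann → Ctx → Exp → Exp → Exp → Set
RedArgEq a Δ A t t' = IfRel a (Σ ℕ λ l → Σ Sort λ s → Σ (⊩ l Δ A s) λ [A] → ⊩Tm [A] t t')

data RedSub (Δ : Ctx) : Ctx → Sub → Set where
  vε : ∀ {σ} → ⊢ Δ → RedSub Δ ε σ
  v▸ : ∀ {Γ a A σ} → RedSub Δ Γ (tailS σ) → RedArg a Δ (sub (tailS σ) A) (σ zero) → RedSub Δ (Γ ▸ (a , A)) σ

data RedSubEq (Δ : Ctx) : Ctx → Sub → Sub → Set where
  eε : ∀ {σ σ'} → RedSubEq Δ ε σ σ'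
  e▸ : ∀ {Γ a A σ σ'} → RedSubEq Δ Γ (tailS σ) (tailS σ') → RedArgEq a Δ (sub (tailS σ) A) (σ zero) (σ' zero) →
       RedSubEq Δ (Γ ▸ (a , A)) σ σ'

record RedEqAt (Δ : Ctx) (s : Sort) (T T' t t' : Exp) : Set where
  constructor vt
  field
    {level} : ℕ
    ty : ⊩ level Δ T s
    teq : ⊩Eq ty T'
    tm : ⊩Tm ty t t'
open RedEqAt public

ValidEqS : Ctx → Exp → Exp → Exp → Sort → Set
ValidEqS Γ t t' T s = ∀ {Δ σ σ'} → RedSub Δ Γ σ → RedSub Δ Γ σ' → RedSubEq Δ Γ σ σ' →
                      RedEqAt Δ s (sub σ T) (sub σ' T) (sub σ t) (sub σ' t')

ValidEq : Ctx → Exp → Exp → Exp → Set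
ValidEq Γ t t' T = Σ Sort (ValidEqS Γ t t' T)

ValidTm : Ctx → Exp → Exp → Set
ValidTm Γ t T = ValidEq Γ t t T

ValidCtx : Ctx → Set
ValidCtx ε = ⊤
ValidCtx (Γ ▸ (a , A)) = ValidCtx Γ × Σ Sort (λ s → ValidTm Γ A (srt s))

redSubCtx : ∀ {Δ Γ σ} → RedSub Δ Γ σ → ⊢ Δ
redSubCtx (vε d) = d
redSubCtx (v▸ v _) = redSubCtx v

reflRedArg : ∀ a {Δ A t} → RedArg a Δ A t → RedArgEq a Δ A t t
reflRedArg rel x = x
reflRedArg irr x = tt

reflRedSubEq : ∀ {Δ Γ σ} → RedSub Δ Γ σ → RedSubEq Δ Γ σ σ
reflRedSubEq (vε _) = eε
reflRedSubEq (v▸ {a = a} v h) = e▸ (reflRedSubEq v) (reflRedArg a h)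

redArg⇒⊢ : ∀ {a Δ A t} → RedArg a Δ A t → argCtx a Δ ⊢ t ∶ A
redArg⇒⊢ (_ , _ , [A] , x) = ⊢t (⊩Tm⇒common [A] x)

castRedArg : ∀ a {Δ A A' t} → A ≣ A' → RedArg a Δ A t → RedArg a Δ A' t
castRedArg _ refl x = x

castRedArgEq : ∀ a {Δ A A' t t'} → A ≣ A' → RedArgEq a Δ A t t' → RedArgEq a Δ A' t t'
castRedArgEq _ refl x = x

⊩U-inv : ∀ {l Δ k s t t'} ([U] : ⊩ l Δ (srt (𝒮 k)) s) → ⊩Tm [U] t t' →
         Common Δ (srt (𝒮 k)) t t' × UEl (levelKit k) Δ k t t'
⊩U-inv (Uᵣ p d h e) (c , ue) with ↘-det h (↘-whnf wh-srt)
... | refl = c , toKit p ue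
⊩U-inv (neᵣ d h n e) _ with ↘-det h (↘-whnf wh-srt)
⊩U-inv (neᵣ d h () e) _ | refl
⊩U-inv (Πᵣ d h e _ _ _) _ with ↘-det h (↘-whnf wh-srt)
... | ()

uL : ∀ {Δ k s t t'} → RedEqAt Δ s (srt (𝒮 k)) (srt (𝒮 k)) t t' → ⊩ k Δ t (𝒮 k)
uL (vt ty _ tm) = proj₁ (proj₂ (⊩U-inv ty tm))

uR : ∀ {Δ k s t t'} → RedEqAt Δ s (srt (𝒮 k)) (srt (𝒮 k)) t t' → ⊩ k Δ t' (𝒮 k)
uR (vt ty _ tm) = proj₁ (proj₂ (proj₂ (⊩U-inv ty tm)))

uEq : ∀ {Δ k s t t'} (v : RedEqAt Δ s (srt (𝒮 k)) (srt (𝒮 k)) t t') → ⊩Eq (uL v) t'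
uEq (vt ty _ tm) = proj₂ (proj₂ (proj₂ (⊩U-inv ty tm)))

uCom : ∀ {Δ k s t t'} → RedEqAt Δ s (srt (𝒮 k)) (srt (𝒮 k)) t t' → Common Δ (srt (𝒮 k)) t t'
uCom (vt ty _ tm) = proj₁ (⊩U-inv ty tm)

⊩U : ∀ {Δ} k → ⊢ Δ → ⊩ (suc k) Δ (srt (𝒮 k)) (𝒮 (suc k))
⊩U k d = Uᵣ ≤′-refl (t-sort d (ax k)) (↘-whnf wh-srt) (e-refl (t-sort d (ax k)))

wkRedArg : ∀ a {Δ' Δ ρ A t} → W Δ' Δ ρ → RedArg a Δ A t → RedArg a Δ' (ren ρ A) (ren ρ t)
wkRedArg a w (l , s , [A] , e) = l , s , wkTy (W-argCtx a w) [A] , wkTm (W-argCtx a w) [A] e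

wkRedArgEq : ∀ a {Δ' Δ ρ A t t'} → W Δ' Δ ρ → RedArgEq a Δ A t t' → RedArgEq a Δ' (ren ρ A) (ren ρ t) (ren ρ t')
wkRedArgEq rel w (l , s , [A] , e) = l , s , wkTy w [A] , wkTm w [A] e
wkRedArgEq irr w _ = tt

wkRedSub : ∀ {Δ' Δ Γ ρ σ} → W Δ' Δ ρ → RedSub Δ Γ σ → RedSub Δ' Γ (ren ρ ∘ σ)
wkRedSub w (vε _) = vε (wΔ w)
wkRedSub {ρ = ρ} {σ = σ} w (v▸ {a = a} {A = A} v h) =
  v▸ (wkRedSub w v) (castRedArg a (ren-sub ρ (tailS σ) A) (wkRedArg a w h))

wkRedSubEq : ∀ {Δ' Δ Γ ρ σ σ'} → W Δ' Δ ρ → RedSubEq Δ Γ σ σ' → RedSubEq Δ' Γ (ren ρ ∘ σ) (ren ρ ∘ σ')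
wkRedSubEq w eε = eε
wkRedSubEq {ρ = ρ} {σ = σ} w (e▸ {a = a} {A = A} v h) =
  e▸ (wkRedSubEq w v) (castRedArgEq a (ren-sub ρ (tailS σ) A) (wkRedArgEq a w h))

argTo⊕ : ∀ a {Δ A t} → RedArg a Δ A t → RedArg rel (Δ ⊕) A t
argTo⊕ rel (l , s , [A] , e) = l , s , toArg irr [A] , toArgTm irr [A] e
argTo⊕ irr x = x

RedSub⊕ : ∀ {Δ Γ σ} → RedSub Δ Γ σ → RedSub (Δ ⊕) (Γ ⊕) σ
RedSub⊕ (vε d) = vε (⊕ctx d)
RedSub⊕ (v▸ {a = a} v h) = v▸ (RedSub⊕ v) (argTo⊕ a h)

lookupRedSubEq : ∀ {Δ Γ σ σ' x a U} → RedSubEq Δ Γ σ σ' → Γ ∋ x ∷[ a ] U → RedArgEq a Δ (sub σ U) (σ x) (σ' x)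
lookupRedSubEq {σ = σ} {a = a} (e▸ v h) (here {U = A}) = castRedArgEq a (sym (sub-wk σ A)) h
lookupRedSubEq {σ = σ} {a = a} (e▸ v h) (there {U = U} p) = castRedArgEq a (sym (sub-wk σ U)) (lookupRedSubEq v p)

castRedEqAt : ∀ {Δ s T T' t t' T₂ T₂' t₂ t₂'} → T ≣ T₂ → T' ≣ T₂' → t ≣ t₂ → t' ≣ t₂' → RedEqAt Δ s T T' t t' →
              RedEqAt Δ s T₂ T₂' t₂ t₂'
castRedEqAt refl refl refl refl x = x

wkValid : ∀ {Γ b t T} → ValidTm Γ t T → ValidTm (Γ ▸ b) (wk t) (wk T)
wkValid {t = t} {T = T} (s , v) = s , λ { {σ = σ} {σ' = σ'} (v▸ vσ _) (v▸ vσ' _) (e▸ e _) →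
  castRedEqAt (sym (sub-wk σ T)) (sym (sub-wk σ' T)) (sym (sub-wk σ t)) (sym (sub-wk σ' t)) (v vσ vσ' e) }

lookCtx : ∀ {Γ x a U} → ValidCtx Γ → Γ ∋ x ∷[ a ] U → Σ Sort λ s → ValidTm Γ U (srt s)
lookCtx {Γ ▸ b} (c , s , v) (here {U = A}) = s , wkValid {b = b} {t = A} {T = srt s} v
lookCtx {Γ ▸ b} (c , _) (there {U = U} p) with lookCtx c p
... | s , v = s , wkValid {b = b} {t = U} {T = srt s} v

symRedSubEq : ∀ {Δ Γ σ σ'} → ValidCtx Γ → RedSub Δ Γ σ → RedSub Δ Γ σ' → RedSubEq Δ Γ σ σ' → RedSubEq Δ Γ σ' σ
symRedSubEq {Γ = ε} _ _ _ _ = eε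
symRedSubEq {Γ = Γ ▸ (rel , A)} (c , 𝒮 k , vA) (v▸ v h) (v▸ v' h') (e▸ e (l , s , [X] , x)) =
  e▸ (symRedSubEq c v v' e)
     (k , 𝒮 k , uR V , convTm (uL V) (uR V) (uEq V) (irrTm [X] (uL V) (symTm [X] x)))
  where V = proj₂ vA v v' e
symRedSubEq {Γ = Γ ▸ (irr , A)} (c , _) (v▸ v _) (v▸ v' _) (e▸ e _) = e▸ (symRedSubEq c v v' e) tt

leftV : ∀ {Γ t t' T} → ValidEq Γ t t' T → ValidTm Γ t T
leftV (s , v) = s , λ vσ vσ' e →
  let v1 = v vσ vσ' e
      v2 = v vσ' vσ' (reflRedSubEq vσ')
  in vt (ty v1) (teq v1) (transTm (ty v1) (tm v1) (symTm (ty v1) (convTm⁻ (ty v1) (ty v2) (teq v1) (tm v2))))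

rightV : ∀ {Γ t t' T} → ValidEq Γ t t' T → ValidTm Γ t' T
rightV (s , v) = s , λ vσ vσ' e →
  let v1 = v vσ vσ' e
      v3 = v vσ vσ (reflRedSubEq vσ)
  in vt (ty v1) (teq v1) (transTm (ty v1) (irrTm (ty v3) (ty v1) (symTm (ty v3) (tm v3))) (tm v1))

toArgEq : ∀ a {l Δ X s B} ([X] : ⊩ l Δ X s) → ⊩Eq [X] B → ⊩Eq (toArg a [X]) B
toArgEq rel [X] e = e
toArgEq irr {X = X} {B = B} [X] e =
  castEq (ren-id X) (wkTy (Wres (wfTm (⊩⇒⊢ [X]))) [X]) (wkEq (Wres (wfTm (⊩⇒⊢ [X]))) [X] e) (ren-id B)

convRedArg⁻ : ∀ a {Δ k s' A A' t} → RedEqAt Δ s' (srt (𝒮 k)) (srt (𝒮 k)) A A' → RedArg a Δ A' t → RedArg a Δ A t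
convRedArg⁻ a {k = k} V (l , s , [X] , x) =
  k , 𝒮 k , toArg a (uL V) ,
  convTm⁻ (toArg a (uL V)) (toArg a (uR V)) (toArgEq a (uL V) (uEq V)) (irrTm [X] (toArg a (uR V)) x)

convRedArgEq⁻ : ∀ a {Δ k s' A A' t t'} → RedEqAt Δ s' (srt (𝒮 k)) (srt (𝒮 k)) A A' → RedArgEq a Δ A' t t' →
                RedArgEq a Δ A t t'
convRedArgEq⁻ rel {k = k} V (l , s , [X] , x) = k , 𝒮 k , uL V , convTm⁻ (uL V) (uR V) (uEq V) (irrTm [X] (uR V) x)
convRedArgEq⁻ irr V _ = tt

convRedSub : ∀ {Γ a U U' s Δ σ} → ValidEq Γ U U' (srt s) → RedSub Δ (Γ ▸ (a , U')) σ → RedSub Δ (Γ ▸ (a , U)) σ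
convRedSub {a = a} {s = 𝒮 k} {σ = σ} vE (v▸ v h) =
  v▸ v (convRedArg⁻ a (proj₂ vE {σ = tailS σ} {σ' = tailS σ} v v (reflRedSubEq v)) h)

convRedSubEq : ∀ {Γ a U U' s Δ σ σ'} → ValidEq Γ U U' (srt s) → RedSub Δ (Γ ▸ (a , U')) σ →
          RedSubEq Δ (Γ ▸ (a , U')) σ σ' → RedSubEq Δ (Γ ▸ (a , U)) σ σ'
convRedSubEq {a = a} {s = 𝒮 k} {σ = σ} vE (v▸ v h) (e▸ e eh) =
  e▸ e (convRedArgEq⁻ a (proj₂ vE {σ = tailS σ} {σ' = tailS σ} v v (reflRedSubEq v)) eh)

ctxConvTm : ∀ {Γ a U U' s t T} → ValidEq Γ U U' (srt s) → ValidTm (Γ ▸ (a , U)) t T → ValidTm (Γ ▸ (a , U')) t T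
ctxConvTm {Γ} {a} {U} {U'} {s} vE (s₀ , vt₁) = s₀ , λ {_} {σ} {σ'} vσ vσ' e →
  vt₁ (convRedSub {Γ} {a} {U} {U'} {s} {σ = σ} vE vσ) (convRedSub {Γ} {a} {U} {U'} {s} {σ = σ'} vE vσ')
      (convRedSubEq {Γ} {a} {U} {U'} {s} {σ = σ} {σ' = σ'} vE vσ e)

var0Arg : ∀ a {l Δ X Y s s'} ([Y] : ⊩ l Δ Y s') → ⊢ (Δ ▸ (a , X)) → Δ ⊢ X ≡ Y ∶ srt s →
          RedArg a (Δ ▸ (a , X)) (ren suc Y) (var zero)
var0Arg rel [Y] d e = _ , _ , wkTy (Wstep d) [Y] , reflNe (wkTy (Wstep d) [Y]) ne-var ne-var dv dv (e-refl dv)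
  where dv = t-conv (t-var d here) (≡ty (wEq (Wstep d) e))
var0Arg irr [Y] d e = _ , _ , wkTy (Wstep (⊕ctx d)) (toArg irr [Y]) ,
  reflNe (wkTy (Wstep (⊕ctx d)) (toArg irr [Y])) ne-var ne-var dv dv (e-refl dv)
  where dv = t-conv (t-var (⊕ctx d) here) (≡ty (wEq (Wstep (⊕ctx d)) (⊕eq e)))

var0ArgEq : ∀ a {l Δ X s} ([X] : ⊩ l Δ X s) → ⊢ (Δ ▸ (a , X)) →
            RedArgEq a (Δ ▸ (a , X)) (ren suc X) (var zero) (var zero)
var0ArgEq rel [X] d = var0Arg rel [X] d (e-refl (⊩⇒⊢ [X]))
var0ArgEq irr [X] d = tt

liftRedSub : ∀ {Δ Γ σ a U l s} → RedSub Δ Γ σ → ([Uσ] : ⊩ l Δ (sub σ U) s) →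
             RedSub (Δ ▸ (a , sub σ U)) (Γ ▸ (a , U)) (liftS σ)
liftRedSub {σ = σ} {a = a} {U = U} v [Uσ] =
  v▸ (wkRedSub (Wstep d) v) (castRedArg a (ren-sub suc σ U) (var0Arg a [Uσ] d (e-refl (⊩⇒⊢ [Uσ]))))
  where d = ▸-wf (redSubCtx v) (⊩⇒⊢ [Uσ])

liftRedSub' : ∀ {Δ Γ σ σ' a U l l' s s' s''} → RedSub Δ Γ σ' → ([Uσ] : ⊩ l Δ (sub σ U) s) →
              ([Uσ'] : ⊩ l' Δ (sub σ' U) s') →
          Δ ⊢ sub σ U ≡ sub σ' U ∶ srt s'' → RedSub (Δ ▸ (a , sub σ U)) (Γ ▸ (a , U)) (liftS σ')
liftRedSub' {σ' = σ'} {a = a} {U = U} v [Uσ] [Uσ'] e =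
  v▸ (wkRedSub (Wstep d) v) (castRedArg a (ren-sub suc σ' U) (var0Arg a [Uσ'] d e))
  where d = ▸-wf (redSubCtx v) (⊩⇒⊢ [Uσ])

liftRedSubEq : ∀ {Δ Γ σ σ' a U l s} → RedSub Δ Γ σ → RedSubEq Δ Γ σ σ' → ([Uσ] : ⊩ l Δ (sub σ U) s) →
          RedSubEq (Δ ▸ (a , sub σ U)) (Γ ▸ (a , U)) (liftS σ) (liftS σ')
liftRedSubEq {σ = σ} {a = a} {U = U} v e [Uσ] =
  e▸ (wkRedSubEq (Wstep d) e) (castRedArgEq a (ren-sub suc σ U) (var0ArgEq a [Uσ] d))
  where d = ▸-wf (redSubCtx v) (⊩⇒⊢ [Uσ])

data ΠV {l Δ a s₁ s₂ U F s} : ⊩ l Δ (Π a s₁ s₂ U F) s → Set where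
  isΠ : (d : Δ ⊢ Π a s₁ s₂ U F ∶ srt s) (h : Π a s₁ s₂ U F ↘ Π a s₁ s₂ U F)
        (e : Δ ⊢ Π a s₁ s₂ U F ≡ Π a s₁ s₂ U F ∶ srt s)
        ([U] : ⊩Dom l Δ U s₁) ([F] : ⊩Cod a [U] F s₂) ([F≡] : ⊩CodExt a [U] F [F]) →
        ΠV (Πᵣ d h e [U] [F] [F≡])

piView : ∀ {l Δ a s₁ s₂ U F s} ([A] : ⊩ l Δ (Π a s₁ s₂ U F) s) → ΠV [A]
piView (Uᵣ p d h e) with ↘-det h (↘-whnf wh-Π)
... | ()
piView (neᵣ d h n e) with ↘-det h (↘-whnf wh-Π)
piView (neᵣ d h () e) | refl
piView (Πᵣ d h e [U] [F] [F≡]) with ↘-det h (↘-whnf wh-Π)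
... | refl = isΠ d h e [U] [F] [F≡]

ifRel⇒RedArgEq : ∀ a {l Δ' X s u u'} ([X] : ⊩ l (argCtx a Δ') X s) → IfRel a (⊩Tm [X] u u') → RedArgEq a Δ' X u u'
ifRel⇒RedArgEq rel [X] e = _ , _ , [X] , e
ifRel⇒RedArgEq irr _ _ = tt

convRedArg : ∀ a {Δ k s' A A' t} → RedEqAt Δ s' (srt (𝒮 k)) (srt (𝒮 k)) A A' → RedArg a Δ A t → RedArg a Δ A' t
convRedArg a {k = k} V (l , s , [X] , x) =
  k , 𝒮 k , toArg a (uR V) ,
  convTm (toArg a (uL V)) (toArg a (uR V)) (toArgEq a (uL V) (uEq V)) (irrTm [X] (toArg a (uL V)) x)

-- The fundamental lemma

module ΠBuild {Γ a i j U T} (vU : ValidTm Γ U (srt (𝒮 i))) (vT : ValidTm (Γ ▸ (a , U)) T (srt (𝒮 j))) where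
  L : ℕ
  L = i ⊔ j
  le₁ : i ≤′ L
  le₁ = ≤⇒≤′ (m≤m⊔n i j)
  le₂ : j ≤′ L
  le₂ = ≤⇒≤′ (m≤n⊔m i j)

  [Uσ] : ∀ {Δ σ} → RedSub Δ Γ σ → ⊩ i Δ (sub σ U) (𝒮 i)
  [Uσ] vσ = uL (proj₂ vU vσ vσ (reflRedSubEq vσ))

  ΠU : ∀ {Δ σ} → RedSub Δ Γ σ → ⊩Dom L Δ (sub σ U) (𝒮 i)
  ΠU {σ = σ} vσ {ρ = ρ} w = liftTy le₁ (castTy (sym (ren-sub ρ σ U)) ([Uσ] (wkRedSub w vσ)))

  ΠArg : ∀ {Δ σ} (vσ : RedSub Δ Γ σ) {Δ' ρ u} (w : W Δ' Δ ρ) → Arg L (lowerKit L) a (ΠU vσ) w u →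
         RedArg a Δ' (sub (ren ρ ∘ σ) U) u
  ΠArg {σ = σ} vσ {ρ = ρ} w du =
    L , 𝒮 i , castTy (ren-sub ρ σ U) (ΠU vσ (argW a w)) , castTm (ren-sub ρ σ U) (ΠU vσ (argW a w)) du

  ΠArgEq : ∀ {Δ σ} (vσ : RedSub Δ Γ σ) {Δ' ρ u u'} (w : W Δ' Δ ρ) → ArgEq L (lowerKit L) a (ΠU vσ) w u u' →
           RedArgEq a Δ' (sub (ren ρ ∘ σ) U) u u'
  ΠArgEq {σ = σ} vσ {ρ = ρ} w e =
    ifRel⇒RedArgEq a (castTy (ren-sub ρ σ U) (ΠU vσ (argW a w))) (mapIfRel a (castTm (ren-sub ρ σ U) (ΠU vσ (argW a w))) e)

  ΠF : ∀ {Δ σ} (vσ : RedSub Δ Γ σ) → ⊩Cod a (ΠU vσ) (sub (liftS σ) T) (𝒮 j)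
  ΠF {σ = σ} vσ {ρ = ρ} {u} w du =
    liftTy le₂ (castTy (cons-ren u ρ σ T) (uL (proj₂ vT vs vs (reflRedSubEq vs))))
    where vs = v▸ {A = U} (wkRedSub w vσ) (ΠArg vσ w du)

  ΠF≡ : ∀ {Δ σ} (vσ : RedSub Δ Γ σ) → ⊩CodExt a (ΠU vσ) (sub (liftS σ) T) (ΠF vσ)
  ΠF≡ {σ = σ} vσ {ρ = ρ} {u} {u'} w du du' e =
    irrEq (castTy (cons-ren u ρ σ T) (uL V)) (ΠF vσ w du)
          (castEq (cons-ren u ρ σ T) (uL V) (uEq V) (cons-ren u' ρ σ T))
    where V = proj₂ vT (v▸ {A = U} (wkRedSub w vσ) (ΠArg vσ w du)) (v▸ {A = U} (wkRedSub w vσ) (ΠArg vσ w du'))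
                       (e▸ {A = U} (reflRedSubEq (wkRedSub w vσ)) (ΠArgEq vσ w e))

  ΠTyJ : ∀ {Δ σ} → RedSub Δ Γ σ → Δ ⊢ Π a (𝒮 i) (𝒮 j) (sub σ U) (sub (liftS σ) T) ∶ srt (𝒮 L)
  ΠTyJ vσ = t-Π (⊢t (uCom (proj₂ vU vσ vσ (reflRedSubEq vσ)))) (⊢t (uCom (proj₂ vT lv lv (reflRedSubEq lv)))) (rl i j)
    where lv = liftRedSub {U = U} vσ ([Uσ] vσ)

  ΠTy : ∀ {Δ σ} → RedSub Δ Γ σ → ⊩ L Δ (Π a (𝒮 i) (𝒮 j) (sub σ U) (sub (liftS σ) T)) (𝒮 L)
  ΠTy vσ = Πᵣ (ΠTyJ vσ) (↘-whnf wh-Π) (e-refl (ΠTyJ vσ)) (ΠU vσ) (ΠF vσ) (ΠF≡ vσ)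

open ΠBuild public

ΠEq : ∀ {Γ a i j U U' T T'} (vU : ValidTm Γ U (srt (𝒮 i))) (vT : ValidTm (Γ ▸ (a , U)) T (srt (𝒮 j)))
      (vU' : ValidTm Γ U' (srt (𝒮 i))) (vT' : ValidTm (Γ ▸ (a , U')) T' (srt (𝒮 j)))
      (vUU' : ValidEq Γ U U' (srt (𝒮 i))) (vTT' : ValidEq (Γ ▸ (a , U)) T T' (srt (𝒮 j)))
      {Δ σ σ'} (vσ : RedSub Δ Γ σ) (vσ' : RedSub Δ Γ σ') (e : RedSubEq Δ Γ σ σ') →
      ⊩Eq (ΠTy {U = U} {T = T} vU vT vσ) (Π a (𝒮 i) (𝒮 j) (sub σ' U') (sub (liftS σ') T'))
ΠEq {Γ} {a} {i} {j} {U} {U'} {T} {T'} vU vT vU' vT' vUU' vTT' {Δ} {σ} {σ'} vσ vσ' e =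
  B'.ΠTyJ vσ' , eqΠ , sub σ' U' , sub (liftS σ') T' , ↘-whnf wh-Π , eqU , eqF
  where
  module B = ΠBuild {Γ} {a} {i} {j} {U} {T} vU vT
  module B' = ΠBuild {Γ} {a} {i} {j} {U'} {T'} vU' vT'
  lv = liftRedSub {U = U} vσ (B.[Uσ] vσ)
  lv' = liftRedSub' {U = U} vσ' (B.[Uσ] vσ) (B.[Uσ] vσ') (⊢≡ (uCom (proj₂ vU vσ vσ' e)))
  le = liftRedSubEq {U = U} vσ e (B.[Uσ] vσ)
  eqΠ = e-Π (⊢≡ (uCom (proj₂ vUU' vσ vσ' e))) (⊢≡ (uCom (proj₂ vTT' lv lv' le))) (rl i j)
  eqU : ∀ {Δ' ρ} (w : W Δ' Δ ρ) → ⊩Eq (B.ΠU vσ w) (ren ρ (sub σ' U'))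
  eqU {ρ = ρ} w = irrEq (castTy (sym (ren-sub ρ σ U)) (uL V)) (B.ΠU vσ w)
                    (castEq (sym (ren-sub ρ σ U)) (uL V) (uEq V) (sym (ren-sub ρ σ' U')))
    where V = proj₂ vUU' (wkRedSub w vσ) (wkRedSub w vσ') (wkRedSubEq w e)
  eqF : ∀ {Δ' ρ u} (w : W Δ' Δ ρ) (du : Arg (i ⊔ j) (lowerKit (i ⊔ j)) a (B.ΠU vσ) w u) →
        ⊩Eq (B.ΠF vσ w du) ((ren (liftR ρ) (sub (liftS σ') T')) [ u ])
  eqF {ρ = ρ} {u} w du = irrEq (castTy (cons-ren u ρ σ T) (uL V)) (B.ΠF vσ w du)
                           (castEq (cons-ren u ρ σ T) (uL V) (uEq V) (cons-ren u ρ σ' T'))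
    where
    hd = B.ΠArg vσ w du
    Vu = proj₂ vU (wkRedSub w vσ) (wkRedSub w vσ') (wkRedSubEq w e)
    V = proj₂ vTT' (v▸ {A = U} (wkRedSub w vσ) hd) (v▸ {A = U} (wkRedSub w vσ') (convRedArg a Vu hd))
                   (e▸ {A = U} (wkRedSubEq w e) (reflRedArg a hd))

validΠEq : ∀ {Γ a i j U U' T T'} → ValidEq Γ U U' (srt (𝒮 i)) → ValidEq (Γ ▸ (a , U)) T T' (srt (𝒮 j)) →
           ValidEq Γ (Π a (𝒮 i) (𝒮 j) U T) (Π a (𝒮 i) (𝒮 j) U' T') (srt (𝒮 (i ⊔ j)))
validΠEq {Γ} {a} {i} {j} {U} {U'} {T} {T'} vUU' vTT' = 𝒮 (suc (i ⊔ j)) , λ {Δ} {σ} {σ'} vσ vσ' e →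
  let dΔ = redSubCtx vσ
      [Π] = B.ΠTy vσ
      d₁ = B.ΠTyJ vσ
      d₂ = B'.ΠTyJ vσ'
      eqΠ = ΠEq {U = U} {U' = U'} {T = T} {T' = T'} vU vT vU' vT' vUU' vTT' vσ vσ' e
  in vt (⊩U (i ⊔ j) dΔ) (reflTy (⊩U (i ⊔ j) dΔ))
     (com d₁ d₂ (⊩Eq⇒⊢≡ [Π] eqΠ) (_ , wh-Π , ↘-whnf wh-Π , e-refl d₁) (_ , wh-Π , ↘-whnf wh-Π , e-refl d₂) ,
      ([Π] , B'.ΠTy vσ' , eqΠ))
  where
  vU : ValidTm Γ U (srt (𝒮 i))
  vU = leftV {Γ} {U} {U'} {srt (𝒮 i)} vUU'
  vT : ValidTm (Γ ▸ (a , U)) T (srt (𝒮 j))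
  vT = leftV {Γ ▸ (a , U)} {T} {T'} {srt (𝒮 j)} vTT'
  vU' : ValidTm Γ U' (srt (𝒮 i))
  vU' = rightV {Γ} {U} {U'} {srt (𝒮 i)} vUU'
  vT' : ValidTm (Γ ▸ (a , U')) T' (srt (𝒮 j))
  vT' = ctxConvTm {Γ} {a} {U} {U'} {𝒮 i} {T'} {srt (𝒮 j)} vUU' (rightV {Γ ▸ (a , U)} {T} {T'} {srt (𝒮 j)} vTT')
  module B = ΠBuild {Γ} {a} {i} {j} {U} {T} vU vT
  module B' = ΠBuild {Γ} {a} {i} {j} {U'} {T'} vU' vT'

ValidArg : Ann → Ctx → Exp → Exp → Set
ValidArg rel Γ u U = ValidTm Γ u U
ValidArg irr Γ u U = ValidTm (Γ ⊕) u U

ValidArgEq : Ann → Ctx → Exp → Exp → Exp → Set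
ValidArgEq rel Γ u u' U = ValidEq Γ u u' U
ValidArgEq irr Γ u u' U = ValidTm (Γ ⊕) u U × ValidTm (Γ ⊕) u' U

argSem : ∀ a {Γ u U Δ σ} → ValidArg a Γ u U → RedSub Δ Γ σ → RedArg a Δ (sub σ U) (sub σ u)
argSem rel (s , v) vσ = let V = v vσ vσ (reflRedSubEq vσ) in _ , s , ty V , tm V
argSem irr (s , v) vσ = let V = v (RedSub⊕ vσ) (RedSub⊕ vσ) (reflRedSubEq (RedSub⊕ vσ)) in _ , s , ty V , tm V

argSemEq : ∀ a {Γ u u' U Δ σ σ'} → ValidArgEq a Γ u u' U → RedSub Δ Γ σ → RedSub Δ Γ σ' → RedSubEq Δ Γ σ σ' →
           RedArgEq a Δ (sub σ U) (sub σ u) (sub σ' u')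
argSemEq rel (s , v) vσ vσ' e = let V = v vσ vσ' e in _ , s , ty V , tm V
argSemEq irr _ _ _ _ = tt

argL : ∀ a {Γ u u' U} → ValidArgEq a Γ u u' U → ValidArg a Γ u U
argL rel {Γ} {u} {u'} {U} v = leftV {Γ} {u} {u'} {U} v
argL irr (v , _) = v

argR : ∀ a {Γ u u' U} → ValidArgEq a Γ u u' U → ValidArg a Γ u' U
argR rel {Γ} {u} {u'} {U} v = rightV {Γ} {u} {u'} {U} v
argR irr (_ , v) = v

argReflV : ∀ a {Γ u U} → ValidArg a Γ u U → ValidArgEq a Γ u u U
argReflV rel v = v
argReflV irr v = v , v

validConv : ∀ {Γ t t' T T' s} → ValidEq Γ t t' T → ValidEq Γ T T' (srt s) → ValidEq Γ t t' T'
validConv {s = 𝒮 k} (_ , vt₁) (_ , vE) = 𝒮 k , λ vσ vσ' e →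
  let V = vt₁ vσ vσ' e
      E1 = vE vσ vσ (reflRedSubEq vσ)
      E2 = vE vσ vσ' e
  in vt (uR E1)
        (transTy (uR E1) (uL E1) (symTy (uL E1) (uR E1) (uEq E1)) (irrEq (uL E2) (uL E1) (uEq E2)))
        (convTm (uL E1) (uR E1) (uEq E1) (irrTm (ty V) (uL E1) (tm V)))

validSym : ∀ {Γ t t' T} → ValidCtx Γ → ValidEq Γ t t' T → ValidEq Γ t' t T
validSym c (s , v) = s , λ vσ vσ' e →
  let V = v vσ' vσ (symRedSubEq c vσ vσ' e)
      V0 = v vσ vσ (reflRedSubEq vσ)
  in vt (ty V0) (symTy (ty V) (ty V0) (teq V)) (convTm (ty V) (ty V0) (teq V) (symTm (ty V) (tm V)))

validTrans : ∀ {Γ t t' t'' T} → ValidEq Γ t t' T → ValidEq Γ t' t'' T → ValidEq Γ t t'' T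
validTrans (s , v1) (_ , v2) = s , λ vσ vσ' e →
  let V1 = v1 vσ vσ' e
      V2 = v2 vσ' vσ' (reflRedSubEq vσ')
  in vt (ty V1) (teq V1) (transTm (ty V1) (tm V1) (convTm⁻ (ty V1) (ty V2) (teq V1) (tm V2)))

validVar : ∀ {Γ x U} → ValidCtx Γ → Γ ∋ x ∶ U → ValidTm Γ (var x) U
validVar c p with lookCtx c (to∷ p)
... | 𝒮 k , (_ , vU) = 𝒮 k , λ vσ vσ' e →
  let V = vU vσ vσ' e
  in vt (uL V) (uEq V) (helper (uL V) (lookupRedSubEq e (to∷ p)))
  where helper : ∀ {l Δ X s t t'} ([X] : ⊩ l Δ X s) → RedArgEq rel Δ X t t' → ⊩Tm [X] t t'
        helper [X] (_ , _ , [Y] , y) = irrTm [Y] [X] y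

castArgId : ∀ a {l Δ U s u} ([U] : ⊩Dom l Δ U s) (d : ⊢ Δ) →
            RedArg a Δ U u → ⊩Tm ([U] (argW a (Wid d))) u u
castArgId a {U = U} [U] d (_ , _ , [X] , x) =
  castTm⁻ (ren-id U) ([U] (argW a (Wid d))) (irrTm [X] (castTy (ren-id U) ([U] (argW a (Wid d)))) x)

castArgEqId : ∀ a {l Δ U s u u'} ([U] : ⊩Dom l Δ U s) (d : ⊢ Δ) →
              RedArgEq a Δ U u u' → IfRel a (⊩Tm ([U] (argW a (Wid d))) u u')
castArgEqId rel {U = U} [U] d (_ , _ , [X] , x) =
  castTm⁻ (ren-id U) ([U] (Wid d)) (irrTm [X] (castTy (ren-id U) ([U] (Wid d))) x)
castArgEqId irr [U] d _ = tt

moveArgId : ∀ a {l Δ U U' s u} ([U] : ⊩Dom l Δ U s) (d : ⊢ Δ) →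
            (∀ {Δ' ρ} (w : W Δ' Δ ρ) → ⊩Eq ([U] w) (ren ρ U')) →
            RedArg a Δ U' u → ⊩Tm ([U] (argW a (Wid d))) u u
moveArgId a {U' = U'} [U] d eqU (_ , _ , [Y] , y) =
  convTm⁻ ([U] (argW a (Wid d))) (castTy (sym (ren-id U')) [Y]) (eqU (argW a (Wid d))) (castTm (sym (ren-id U')) [Y] y)

⊩app : ∀ {l Δ a s s' sΠ U T U' T' f f' u u₁ u'}
          ([Π] : ⊩ l Δ (Π a s s' U T) sΠ) → ⊩Eq [Π] (Π a s s' U' T') → ⊩Tm [Π] f f' →
          RedArg a Δ U u → RedArg a Δ U' u₁ → RedArg a Δ U' u' → RedArgEq a Δ U u u₁ → RedArgEq a Δ U u u' →
          RedEqAt Δ s' (T [ u ]) (T' [ u₁ ]) (app a f u) (app a f' u')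
⊩app {Δ = Δ} {a = a} {s' = s'} {U = U} {T = T} {T' = T'} {f = f} {f' = f'} {u = u} {u₁ = u₁} {u' = u'}
        [Π] eqΠ ftm hu hu₁ hu' e₁ e' with piView [Π]
... | isΠ d h e [U] [F] [F≡] with eqΠ | ftm
... | (_ , _ , _ , _ , hB , eqU , eqF) | (c , g) with ↘-det (↘-whnf wh-Π) hB
... | refl = vt [Fu] teq' tm'
  where
  dΔ = wfTm d
  du  = castArgId a [U] dΔ hu
  du₁ = moveArgId a [U] dΔ eqU hu₁
  du' = moveArgId a [U] dΔ eqU hu'
  eT : ∀ X → (ren (liftR (λ n → n)) X) [ u ] ≣ X [ u ]
  eT X = cong (_[ u ]) (ren-liftR-id X)
  [Fu] = castTy (eT T) ([F] (Wid dΔ) du)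
  teq' : ⊩Eq [Fu] (T' [ u₁ ])
  teq' = castEq (eT T) ([F] (Wid dΔ) du)
           (transTy ([F] (Wid dΔ) du) ([F] (Wid dΔ) du₁) ([F≡] (Wid dΔ) du du₁ (castArgEqId a [U] dΔ e₁))
                    (eqF (Wid dΔ) du₁))
           (cong (_[ u₁ ]) (ren-liftR-id T'))
  tm' : ⊩Tm [Fu] (app a f u) (app a f' u')
  tm' = castTm (eT T) ([F] (Wid dΔ) du)
          (≣Tm ([F] (Wid dΔ) du) (cong (λ X → app a X u) (ren-id f)) (cong (λ X → app a X u') (ren-id f'))
               (g (Wid dΔ) du du' (castArgEqId a [U] dΔ e')))

validAppEq : ∀ {Γ a s s' U T t t' u u'} → ValidEq Γ t t' (Π a s s' U T) → ValidArgEq a Γ u u' U →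
             ValidEq Γ (app a t u) (app a t' u') (T [ u ])
validAppEq {Γ} {a} {s} {s'} {U} {T} {t} {t'} {u} {u'} (_ , vt₁) vu = s' , λ {Δ} {σ} {σ'} vσ vσ' e →
  let V = vt₁ vσ vσ' e
      hu  = argSem a (argL a vu) vσ
      hu₁ = argSem a (argL a vu) vσ'
      hu' = argSem a (argR a vu) vσ'
      e₁ = argSemEq a (argReflV a (argL a vu)) vσ vσ' e
      e' = argSemEq a vu vσ vσ' e
  in castRedEqAt (sym (sub-single σ T u)) (sym (sub-single σ' T u)) refl refl
       (⊩app (ty V) (teq V) (tm V) hu hu₁ hu' e₁ e')

expTmʳ : ∀ {l Γ A s x t t₁} ([A] : ⊩ l Γ A s) → t ⇒ t₁ → Γ ⊢ t ∶ A → Γ ⊢ t ≡ t₁ ∶ A → ⊩Tm [A] x t₁ → ⊩Tm [A] x t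
expTmʳ [A] st dt et x = symTm [A] (expTm [A] st dt et (symTm [A] x))

var0Ty : ∀ a {Δ A} → ⊢ (Δ ▸ (a , A)) → (Δ ▸ (a , A)) ⊢ var zero ⦂[ a ] wk A
var0Ty rel d = ⦂rel (t-var d here)
var0Ty irr d = ⦂irr (t-var (⊕ctx d) here)

validSort : ∀ {Γ i} → ValidTm Γ (srt (𝒮 i)) (srt (𝒮 (suc i)))
validSort {i = i} = 𝒮 (suc (suc i)) , λ vσ vσ' e →
  let d = redSubCtx vσ
      dS = t-sort d (ax i)
      r = (srt (𝒮 i) , wh-srt , ↘-whnf wh-srt , e-refl dS)
  in vt (⊩U (suc i) d) (reflTy (⊩U (suc i) d)) (com dS dS (e-refl dS) r r , (⊩U i d , ⊩U i d , reflTy (⊩U i d)))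

validLam : ∀ {Γ a i j U U' T b b'} → ValidEq Γ U U' (srt (𝒮 i)) → ValidTm (Γ ▸ (a , U)) T (srt (𝒮 j)) →
           ValidEq (Γ ▸ (a , U)) b b' T → ValidEq Γ (lam a U b) (lam a U' b') (Π a (𝒮 i) (𝒮 j) U T)
validLam {Γ} {a} {i} {j} {U} {U'} {T} {b} {b'} vUU' vT vbb' = 𝒮 (i ⊔ j) , valid
  where
  vU : ValidTm Γ U (srt (𝒮 i))
  vU = leftV {Γ} {U} {U'} {srt (𝒮 i)} vUU'
  vU' : ValidTm Γ U' (srt (𝒮 i))
  vU' = rightV {Γ} {U} {U'} {srt (𝒮 i)} vUU'
  vT' : ValidTm (Γ ▸ (a , U')) T (srt (𝒮 j))
  vT' = ctxConvTm {Γ} {a} {U} {U'} {𝒮 i} {T} {srt (𝒮 j)} vUU' vT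
  vb' : ValidTm (Γ ▸ (a , U')) b' T
  vb' = ctxConvTm {Γ} {a} {U} {U'} {𝒮 i} {b'} {T} vUU' (rightV {Γ ▸ (a , U)} {b} {b'} {T} vbb')
  module B = ΠBuild {Γ} {a} {i} {j} {U} {T} vU vT
  module B' = ΠBuild {Γ} {a} {i} {j} {U'} {T} vU' vT'
  valid : ValidEqS Γ (lam a U b) (lam a U' b') (Π a (𝒮 i) (𝒮 j) U T) (𝒮 (i ⊔ j))
  valid {Δ} {σ} {σ'} vσ vσ' e =
    vt (B.ΠTy vσ) (ΠEq {U = U} {U' = U} {T = T} {T' = T} vU vT vU vT vU vT vσ vσ' e) (c , ⊩app-lam)
    where
    VU = proj₂ vU vσ vσ (reflRedSubEq vσ)
    VUσσ' = proj₂ vUU' vσ vσ' e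
    VUσ' = proj₂ vU vσ' vσ' (reflRedSubEq vσ')
    lv = liftRedSub {U = U} vσ (uL VU)
    lv' = liftRedSub' {U = U} vσ' (uL VU) (uL VUσ') (⊢≡ (uCom (proj₂ vU vσ vσ' e)))
    le = liftRedSubEq {U = U} vσ e (uL VU)
    Vb = proj₂ vbb' lv lv' le
    dbody : (Δ ▸ (a , sub σ U)) ⊢ sub (liftS σ) b ∶ sub (liftS σ) T
    dbody = ⊢t (⊩Tm⇒common (ty Vb) (tm Vb))
    VT0 = proj₂ vT lv lv (reflRedSubEq lv)
    dT : (Δ ▸ (a , sub σ U)) ⊢ sub (liftS σ) T ∶ srt (𝒮 j)
    dT = ⊢t (uCom VT0)
    dΠ = B.ΠTyJ vσ
    dlam : Δ ⊢ lam a (sub σ U) (sub (liftS σ) b) ∶ Π a (𝒮 i) (𝒮 j) (sub σ U) (sub (liftS σ) T)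
    dlam = t-lam dbody dΠ
    VU'σ' = proj₂ vU' vσ' vσ' (reflRedSubEq vσ')
    lv2 = liftRedSub {U = U'} vσ' (uL VU'σ')
    Vb2 = proj₂ vb' lv2 lv2 (reflRedSubEq lv2)
    dbody' : (Δ ▸ (a , sub σ' U')) ⊢ sub (liftS σ') b' ∶ sub (liftS σ') T
    dbody' = ⊢t (⊩Tm⇒common (ty Vb2) (tm Vb2))
    dΠ' = B'.ΠTyJ vσ'
    E = ΠEq {U = U} {U' = U'} {T = T} {T' = T} vU vT vU' vT' vUU' vT vσ vσ' e
    dlam' : Δ ⊢ lam a (sub σ' U') (sub (liftS σ') b') ∶ Π a (𝒮 i) (𝒮 j) (sub σ U) (sub (liftS σ) T)
    dlam' = t-conv (t-lam dbody' dΠ') (≡ty (e-sym (⊩Eq⇒⊢≡ (B.ΠTy vσ) E)))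
    eqlam = e-lam (⊢≡ (uCom VUσσ')) dT (⊢≡ (⊩Tm⇒common (ty Vb) (tm Vb)))
    c = com dlam dlam' eqlam (_ , wh-lam , ↘-whnf wh-lam , e-refl dlam) (_ , wh-lam , ↘-whnf wh-lam , e-refl dlam')
    eqFE = proj₂ (proj₂ (proj₂ (proj₂ (proj₂ (proj₂ E)))))
    ⊩app-lam : ∀ {Δ' ρ u u''} (w : W Δ' Δ ρ) (du : Arg (i ⊔ j) (lowerKit (i ⊔ j)) a (B.ΠU vσ) w u)
             (du' : Arg (i ⊔ j) (lowerKit (i ⊔ j)) a (B.ΠU vσ) w u'') →
                    ArgEq (i ⊔ j) (lowerKit (i ⊔ j)) a (B.ΠU vσ) w u u'' →
             ⊩Tm (B.ΠF vσ w du) (app a (ren ρ (lam a (sub σ U) (sub (liftS σ) b))) u)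
                                 (app a (ren ρ (lam a (sub σ' U') (sub (liftS σ') b'))) u'')
    ⊩app-lam {Δ'} {ρ} {u} {u''} w du du' e' = expTm [Fu] ⇒β tyL βL (expTmʳ [Fu] ⇒β tyR βR x)
      where
      [Fu] = B.ΠF vσ w du
      hd = B.ΠArg vσ w du
      hd' = B.ΠArg vσ w du'
      VUτ = proj₂ vU (wkRedSub w vσ) (wkRedSub w vσ') (wkRedSubEq w e)
      V = proj₂ vbb' (v▸ {A = U} (wkRedSub w vσ) hd) (v▸ {A = U} (wkRedSub w vσ') (convRedArg a VUτ hd'))
                     (e▸ {A = U} (wkRedSubEq w e) (B.ΠArgEq vσ w e'))
      x₀ : ⊩Tm [Fu] (sub (cons u (ren ρ ∘ σ)) b) (sub (cons u'' (ren ρ ∘ σ')) b')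
      x₀ = irrTm (castTy (cons-ren u ρ σ T) (ty V)) [Fu] (castTm (cons-ren u ρ σ T) (ty V) (tm V))
      x = ≣Tm [Fu] (cons-ren u ρ σ b) (cons-ren u'' ρ σ' b') x₀
      tyL = appTy (e-refl dΠ) (B.ΠU vσ) w dlam du
      βL = e-β (renTm (rlift (rbase w) ≤ₐ-refl) dbody) (⊢arg a (⊢t (⊩Tm⇒common (B.ΠU vσ (argW a w)) du)))
      eFF = ⊩Eq⇒⊢≡ (B.ΠF vσ w du') (B.ΠF≡ vσ w du' du (mapIfRel a (symTm (B.ΠU vσ (argW a w))) e'))
      tyR = t-conv (appTy (e-refl dΠ) (B.ΠU vσ) w dlam' du') (≡ty eFF)
      eqUU'w = wEq (argW a w) (⊢≡ (uCom VUσσ'))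
      βR₀ = e-β (renTm (rlift (rbase w) ≤ₐ-refl) dbody')
                (⊢arg a (t-conv (⊢t (⊩Tm⇒common (B.ΠU vσ (argW a w)) du')) (≡ty eqUU'w)))
      βR = e-conv βR₀ (≡ty (e-trans (e-sym (⊩Eq⇒⊢≡ (B.ΠF vσ w du') (eqFE w du'))) eFF))

validβ : ∀ {Γ a U b T u} → ValidCtx (Γ ▸ (a , U)) → ValidTm (Γ ▸ (a , U)) b T → ValidArg a Γ u U →
         ValidEq Γ (app a (lam a U b) u) (b [ u ]) (T [ u ])
validβ {Γ} {a} {U} {b} {T} {u} (c , 𝒮 k , vU) (𝒮 j , vb) vu = 𝒮 j , valid
  where
  valid : ValidEqS Γ (app a (lam a U b) u) (b [ u ]) (T [ u ]) (𝒮 j)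
  valid {Δ} {σ} {σ'} vσ vσ' e = vt [T] teq' (expTm [T] ⇒β tyL βL x)
    where
    hu = argSem a vu vσ
    hu' = argSem a vu vσ'
    he = argSemEq a (argReflV a vu) vσ vσ' e
    V = vb (v▸ {A = U} vσ hu) (v▸ {A = U} vσ' hu') (e▸ {A = U} e he)
    [T] = castTy (sym (sub-single-cons σ T u)) (ty V)
    teq' = castEq (sym (sub-single-cons σ T u)) (ty V) (teq V) (sym (sub-single-cons σ' T u))
    x = castTm (sym (sub-single-cons σ T u)) (ty V)
          (≣Tm (ty V) (cons-split (sub σ u) σ b) (sym (sub-single-cons σ' b u)) (tm V))
    VUσ = proj₂ vU vσ vσ (reflRedSubEq vσ)
    lv = liftRedSub {U = U} vσ (uL VUσ)
    Vb0 = vb lv lv (reflRedSubEq lv)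
    dbody = ⊢t (⊩Tm⇒common (ty Vb0) (tm Vb0))
    dΠ = t-Π (⊢t (uCom VUσ)) (⊩⇒⊢ (ty Vb0)) (rl k j)
    dlam = t-lam dbody dΠ
    darg = ⊢arg a (redArg⇒⊢ {a} hu)
    tyL = ≣ty (sym (sub-single σ T u)) (t-app dlam darg)
    βL = ≣eq refl refl (sym (sub-single σ T u)) (e-β dbody darg)

⊩η : ∀ {l l' Δ a s s' sΠ sΠ' U T U' T' f f'}
          ([Π] : ⊩ l Δ (Π a s s' U T) sΠ) → ⊩Eq [Π] (Π a s s' U' T') → ([Π'] : ⊩ l' Δ (Π a s s' U' T') sΠ') →
          ⊩Tm [Π] f f' → ⊩Tm [Π'] f' f' → ⊩Tm [Π] f (lam a U' (app a (wk f') (var zero)))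
⊩η {a = a} {U' = U'} {T' = T'} {f' = f'} [Π] eqΠ [Π'] m m' with piView [Π] | piView [Π']
... | isΠ d h e [U] [F] [F≡] | isΠ d' _ _ _ _ _ with eqΠ | m
... | (_ , eΠ , _ , _ , hB , eqU , eqF) | (c , g) with ↘-det (↘-whnf wh-Π) hB
... | refl = com (⊢t c) dηΠ eqf (red c) (_ , wh-lam , ↘-whnf wh-lam , e-refl dηΠ) , ⊩app-η
  where
  dU' = proj₁ (invΠ d')
  dctx = ▸-wf (wfTm d') dU'
  df' = ⊢t (⊩Tm⇒common [Π'] m')
  dbody : (_ ▸ (a , U')) ⊢ app a (wk f') (var zero) ∶ T'
  dbody = ≣ty (liftR-suc-var0 T') (t-app (wTm (Wstep dctx) df') (var0Ty a dctx))
  dη = t-lam dbody d'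
  dηΠ = t-conv dη (≡ty (e-sym eΠ))
  eqf = e-trans (⊢≡ c) (e-conv (e-η df') (≡ty (e-sym eΠ)))
  ⊩app-η : ∀ {Δ' ρ u u'} (w : W Δ' _ ρ) (du : Arg _ _ a [U] w u) (du' : Arg _ _ a [U] w u') →
           ArgEq _ _ a [U] w u u' →
           ⊩Tm ([F] w du) (app a (ren ρ _) u) (app a (ren ρ (lam a U' (app a (wk f') (var zero)))) u')
  ⊩app-η {ρ = ρ} {u} {u'} w du du' e' = expTmʳ ([F] w du) ⇒β tyR βR y'
    where
    y' = ≣Tm ([F] w du) refl (cong (λ X → app a X u') (sym (wk-ren-single ρ f' u'))) (g w du du' e')
    eFF = ⊩Eq⇒⊢≡ ([F] w du') ([F≡] w du' du (mapIfRel a (symTm ([U] (argW a w))) e'))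
    tyR = t-conv (appTy (e-refl d) [U] w dηΠ du') (≡ty eFF)
    βR₀ = e-β (renTm (rlift (rbase w) ≤ₐ-refl) dbody)
              (⊢arg a (t-conv (⊢t (⊩Tm⇒common ([U] (argW a w)) du')) (≡ty (⊩Eq⇒⊢≡ ([U] (argW a w)) (eqU (argW a w))))))
    βR = e-conv βR₀ (≡ty (e-trans (e-sym (⊩Eq⇒⊢≡ ([F] w du') (eqF w du'))) eFF))

validη : ∀ {Γ a s s' U T t} → ValidTm Γ t (Π a s s' U T) →
         ValidEq Γ t (lam a U (app a (wk t) (var zero))) (Π a s s' U T)
validη {Γ} {a} {s} {s'} {U} {T} {t} (sΠ , v) = sΠ , λ {Δ} {σ} {σ'} vσ vσ' e →
  let V = v vσ vσ' e
      V' = v vσ' vσ' (reflRedSubEq vσ')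
  in vt (ty V) (teq V)
        (≣Tm (ty V) refl (cong (λ X → lam a (sub σ' U) (app a X (var zero))) (sym (wk-liftS σ' t)))
             (⊩η (ty V) (teq V) (ty V') (tm V) (tm V')))

mutual
  fundCtx : ∀ {Γ} → ⊢ Γ → ValidCtx Γ
  fundCtx ε-wf = tt
  fundCtx (▸-wf {s = s} dΓ dA) = fundCtx dΓ , s , proj₂ (fundTm dA)

  fundTm : ∀ {Γ t T} → Γ ⊢ t ∶ T → ValidCtx Γ × ValidTm Γ t T
  fundTm (t-sort d (ax i)) = fundCtx d , validSort
  fundTm (t-Π {Γ} {a} {U} {T} dU dT (rl i j)) =
    proj₁ (fundTm dU) , validΠEq {Γ} {a} {i} {j} {U} {U} {T} {T} (proj₂ (fundTm dU)) (proj₂ (fundTm dT))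
  fundTm (t-var d x) = fundCtx d , validVar (fundCtx d) x
  fundTm (t-lam {Γ} {a} {U} {b} {T} {𝒮 i} {𝒮 j} db dΠ) =
    proj₁ (fundTm dΠ) ,
    validLam {Γ} {a} {i} {j} {U} {U} {T} {b} {b} (proj₁ (fundΠinv dΠ)) (proj₂ (fundΠinv dΠ)) (proj₂ (fundTm db))
  fundTm (t-app {Γ} {a} {t} {u} {U} {T} {s} {s'} dt du) =
    proj₁ (fundTm dt) ,
    validAppEq {Γ} {a} {s} {s'} {U} {T} {t} {t} {u} {u} (proj₂ (fundTm dt)) (argReflV a (fundArg du))
  fundTm (t-conv {Γ} {t} {T} {T'} d e) =
    proj₁ (fundTm d) , validConv {Γ} {t} {t} {T} {T'} {proj₁ (fundTyEq e)} (proj₂ (fundTm d)) (proj₂ (fundTyEq e))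

  fundΠinv : ∀ {Γ a s s' U T X} → Γ ⊢ Π a s s' U T ∶ X → ValidTm Γ U (srt s) × ValidTm (Γ ▸ (a , U)) T (srt s')
  fundΠinv (t-Π dU dT _) = proj₂ (fundTm dU) , proj₂ (fundTm dT)
  fundΠinv (t-conv d _) = fundΠinv d

  fundArg : ∀ {Γ u a U} → Γ ⊢ u ⦂[ a ] U → ValidArg a Γ u U
  fundArg (⦂rel d) = proj₂ (fundTm d)
  fundArg (⦂irr d) = proj₂ (fundTm d)

  fundArgEq : ∀ {Γ u u' a U} → Γ ⊢ u ≡ u' ⦂[ a ] U → ValidArgEq a Γ u u' U
  fundArgEq (≡rel e) = proj₂ (fundEq e)
  fundArgEq (≡irr d d') = proj₂ (fundTm d) , proj₂ (fundTm d')

  fundTyEq : ∀ {Γ T T'} → Γ ⊢ T ≡ty T' → Σ Sort (λ s → ValidEq Γ T T' (srt s))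
  fundTyEq (≡ty {s = s} e) = s , proj₂ (fundEq e)

  fundEq : ∀ {Γ t t' T} → Γ ⊢ t ≡ t' ∶ T → ValidCtx Γ × ValidEq Γ t t' T
  fundEq (e-β {Γ} {a} {U} {t} {T} {u} db du) =
    proj₁ (proj₁ (fundTm db)) , validβ {Γ} {a} {U} {t} {T} {u} (proj₁ (fundTm db)) (proj₂ (fundTm db)) (fundArg du)
  fundEq (e-η {Γ} {a} {U} {T} {s} {s'} {t} d) = proj₁ (fundTm d) , validη {Γ} {a} {s} {s'} {U} {T} {t} (proj₂ (fundTm d))
  fundEq (e-refl d) = fundTm d
  fundEq (e-sym {Γ} {t} {t'} {T} e) = proj₁ (fundEq e) , validSym {Γ} {t} {t'} {T} (proj₁ (fundEq e)) (proj₂ (fundEq e))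
  fundEq (e-trans {Γ} {t} {t'} {t''} {T} e e') =
    proj₁ (fundEq e) , validTrans {Γ} {t} {t'} {t''} {T} (proj₂ (fundEq e)) (proj₂ (fundEq e'))
  fundEq (e-Π {Γ} {a} {U} {U'} {T} {T'} eU eT (rl i j)) =
    proj₁ (fundEq eU) , validΠEq {Γ} {a} {i} {j} {U} {U'} {T} {T'} (proj₂ (fundEq eU)) (proj₂ (fundEq eT))
  fundEq (e-lam {Γ} {a} {U} {U'} {T} {t} {t'} {𝒮 i} {𝒮 j} eU dT eb) =
    proj₁ (fundEq eU) ,
    validLam {Γ} {a} {i} {j} {U} {U'} {T} {t} {t'} (proj₂ (fundEq eU)) (proj₂ (fundTm dT)) (proj₂ (fundEq eb))
  fundEq (e-app {Γ} {a} {t} {t'} {u} {u'} {U} {T} {s} {s'} e e') =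
    proj₁ (fundEq e) , validAppEq {Γ} {a} {s} {s'} {U} {T} {t} {t'} {u} {u'} (proj₂ (fundEq e)) (fundArgEq e')
  fundEq (e-conv {Γ} {t} {t'} {T} {T'} e e') =
    proj₁ (fundEq e) ,
    validConv {Γ} {t} {t'} {T} {T'} {proj₁ (fundTyEq e')} (proj₂ (fundEq e)) (proj₂ (fundTyEq e'))

idRedSub : ∀ {Γ} → ValidCtx Γ → ⊢ Γ → RedSub Γ Γ var
idRedSub {ε} _ d = vε d
idRedSub {Γ ▸ (a , A)} (c , 𝒮 k , vA) (▸-wf dΓ dA) = v▸ (wkRedSub (Wstep d) iv) hd
  where
  d = ▸-wf dΓ dA
  iv = idRedSub c dΓ
  V = proj₂ vA iv iv (reflRedSubEq iv)
  [A] = castTy (sub-id A) (uL V)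
  hd : RedArg a (Γ ▸ (a , A)) (sub (tailS var) A) (var zero)
  hd = castRedArg a (ren-as-sub suc A) (var0Arg a [A] d (e-refl dA))

validTm⇒WhNorm : ∀ {Γ t T} → ValidCtx Γ → ⊢ Γ → ValidTm Γ t T → WhNorm Γ t T
validTm⇒WhNorm {Γ} {t} {T} c dΓ (_ , v) = unsubst (red (⊩Tm⇒common (ty V) (tm V)))
  where
  ι = idRedSub c dΓ
  V = v ι ι (reflRedSubEq ι)
  unsubst : WhNorm Γ (sub var t) (sub var T) → WhNorm Γ t T
  unsubst (a , wa , h , e) = a , wa , subst (_↘ a) (sub-id t) h , ≣eq (sub-id t) refl (sub-id T) e

theorem5p9 : ∀ {Γ t T} → Γ ⊢ t ∶ T →
    Σ Exp (λ a → Whnf a × (t ↘ a) × (Γ ⊢ t ≡ a ∶ T))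
theorem5p9 d = validTm⇒WhNorm (proj₁ (fundTm d)) (wfTm d) (proj₂ (fundTm d))
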